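{- Let $\pi_1$ and $\pi_2$ be labeled permutations on disjoint alphabets and $\pi=\pi_1\cdot\pi_2$ their concatenation. The marked profile of $\pi$ is determined by those of $\pi_1$ and $\pi_2$ as follows: (i) if $\pi_1$ has marked profile $(m|a,p')$ and $\pi_2$ has $(n|b,q')$, then $\pi$ has $(m+n+1\,|\,a+b+1,\ p'\uplus q')$; (ii) if $\pi_1$ has $(m|a,p')$ and $\pi_2$ has $(n_l\odot n_r,q')$, then $\pi$ has $((m+n_l+1)\odot n_r,\ p'\uplus q')$; (iii) if $\pi_1$ has $(m_l\odot m_r,p')$ and $\pi_2$ has $(n|b,q')$, then $\pi$ has $(m_l\odot(m_r+n+1),\ p'\uplus q')$; (iv) if $\pi_1$ has $(m_l\odot m_r,p')$ and $\pi_2$ has $(n_l\odot n_r,q')$, then $\pi$ has $(m_l\odot n_r,\ p'\uplus q'\uplus(m_r+n_l+1))$. In particular $\pi_1\cdot\pi_2$ has a marking of the first type if and only if both $\pi_1$ and $\pi_2$ do.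
   Context: A labeled permutation on a finite alphabet $\mathcal A$, $|\mathcal A|=n$, is a pair of bijections $\pi_t,\pi_b:\mathcal A\to\{1,\dots,n\}$, written as a two-row array with top row $\pi_t^{ -1}(1),\dots,\pi_t^{ -1}(n)$ and bottom row $\pi_b^{ -1}(1),\dots,\pi_b^{ -1}(n)$. The concatenation $\pi_1\cdot\pi_2$ of labeled permutations on disjoint alphabets is the labeled permutation on the union whose top (resp. bottom) row is the top (resp. bottom) row of $\pi_1$ followed by that of $\pi_2$. Interval diagram: with symbols $a^{out},a^{in}$ define $\tilde\sigma(a^{out})=(\pi_t^{ -1}(1))^{out}$ if $\pi_b(a)=1$ and $(\pi_b^{ -1}(\pi_b(a)-1))^{in}$ otherwise; $\tilde\sigma(a^{in})=(\pi_t^{ -1}(\pi_t(a)+1))^{out}$ if $\pi_t(a)\ne n$ and $(\pi_b^{ -1}(n))^{in}$ otherwise. In the set of symbols identify $(\pi_b^{ -1}(1))^{out},(\pi_t^{ -1}(1))^{out}$ into $L$ and $(\pi_t^{ -1}(n))^{in},(\pi_b^{ -1}(n))^{in}$ into $R$; $\sigma_\pi(L)=\tilde\sigma((\pi_t^{ -1}(1))^{out})$, $\sigma_\pi(R)=\tilde\sigma((\pi_b^{ -1}(n))^{in})$, $\sigma_\pi=\tilde\sigma$ elsewhere. Cycles of $\sigma_\pi$ have even lengths $2m$; the profile is the multiset of these $m$. If $L,R$ are in one cycle of length $2m$ and $2a$ elements lie strictly between $L$ and $R$ along $\sigma_\pi$ starting from $L$, the marking is $m|a$ (first type); otherwise,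 with the cycles of $L$ and $R$ of lengths $2m_l,2m_r$, the marking is $m_l\odot m_r$ (second type). The marked profile is $(m|a,p')$, $p'$ = profile minus one part $m$, resp. $(m_l\odot m_r,p')$, $p'$ = profile minus parts $m_l,m_r$. $\uplus$ is multiset union. -}

module Defs where

open import Data.Nat using (ℕ; zero; suc; _+_; _*_; _<_)
import Data.Nat as ℕ
open import Data.Fin using (Fin; zero; suc; toℕ; fromℕ; inject₁; lower₁)
open import Data.Fin.Properties using (+↔⊎)
open import Data.Sum using (_⊎_; inj₁; inj₂)
open import Data.Sum.Function.Propositional using (_⊎-↔_)
open import Data.Product using (Σ; ∃; _×_; _,_; proj₁; proj₂)
open import Data.List using (List; []; _∷_; map)
open import Data.List.Relation.Unary.All using (All)
open import Data.List.Relation.Unary.Any using (Any)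
open import Data.List.Relation.Unary.AllPairs using (AllPairs)
open import Data.List.Relation.Binary.Permutation.Propositional using (_↭_)
open import Function.Bundles using (_↔_; Inverse)
open import Function.Properties.Inverse using (↔-sym; ↔-trans)
open import Relation.Binary.PropositionalEquality using (_≡_; _≢_)
open import Relation.Nullary using (¬_; yes; no)

-- An alphabet is any type A; a labeled permutation on A with |A| = suc n
-- is a pair of bijections  π_t, π_b : A ↔ Fin (suc n).
-- Positions are 0-based: position 1 of the paper is 'zero',
-- position |A| of the paper is 'fromℕ n'.

record LabPerm (A : Set) (n : ℕ) : Set where
  field
    top : A ↔ Fin (suc n)
    bot : A ↔ Fin (suc n)

  πt πb : A → Fin (suc n)
  πt = Inverse.to top
  πb = Inverse.to bot

  πt⁻¹ πb⁻¹ : Fin (suc n) → A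
  πt⁻¹ = Inverse.from top
  πb⁻¹ = Inverse.from bot

open LabPerm public

-- Concatenation of labeled permutations on disjoint alphabets A and B
-- (disjoint union A ⊎ B): top row of π₁ followed by top row of π₂, and
-- likewise for the bottom rows.
_·_ : ∀ {A B : Set} {n₁ n₂ : ℕ} → LabPerm A n₁ → LabPerm B n₂ →
      LabPerm (A ⊎ B) (n₁ + suc n₂)
π₁ · π₂ = record
  { top = ↔-trans (top π₁ ⊎-↔ top π₂) (↔-sym +↔⊎)
  ; bot = ↔-trans (bot π₁ ⊎-↔ bot π₂) (↔-sym +↔⊎)
  }

data Sym (A : Set) : Set where
  out : A → Sym A
  inn : A → Sym A

iter : ∀ {X : Set} → (X → X) → ℕ → X → X
iter f zero    x = x
iter f (suc k) x = f (iter f k x)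

module _ {A : Set} {n : ℕ} (π : LabPerm A n) where

  σ̃ : Sym A → Sym A
  σ̃ (out a) with πb π a
  ... | zero  = out (πt⁻¹ π zero)
  ... | suc j = inn (πb⁻¹ π (inject₁ j))
  σ̃ (inn a) with n ℕ.≟ toℕ (πt π a)
  ... | yes _ = inn (πb⁻¹ π (fromℕ n))
  ... | no ne = out (πt⁻¹ π (suc (lower₁ (πt π a) ne)))

  -- the identified points, represented by canonical symbols:
  -- L is represented by (π_t⁻¹(1))^out, R by (π_b⁻¹(n))^in.
  Lsym Rsym : Sym A
  Lsym = out (πt⁻¹ π zero)
  Rsym = inn (πb⁻¹ π (fromℕ n))

  -- canonical representative of the class of a symbol after the
  -- identifications (π_b⁻¹(1))^out ~ L and (π_t⁻¹(n))^in ~ R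
  canon : Sym A → Sym A
  canon (out a) with πb π a
  ... | zero  = Lsym
  ... | suc _ = out a
  canon (inn a) with n ℕ.≟ toℕ (πt π a)
  ... | yes _ = Rsym
  ... | no _  = inn a

  -- the elements of the quotient set are the canonical symbols
  Canonical : Sym A → Set
  Canonical x = canon x ≡ x

  -- σ_π on the quotient set (acting on canonical representatives);
  -- σ_π(L) = σ̃((π_t⁻¹(1))^out), σ_π(R) = σ̃((π_b⁻¹(n))^in), σ_π = σ̃ elsewhere
  σ : Sym A → Sym A
  σ x = canon (σ̃ x)

  CycleLen : Sym A → ℕ → Set
  CycleLen x k = 0 < k × iter σ k x ≡ x
               × (∀ j → 0 < j → j < k → iter σ j x ≢ x)

  SameCycle : Sym A → Sym A → Set
  SameCycle x y = ∃ λ k → iter σ k x ≡ y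

  -- ps is the profile of π: the multiset of the m's, over the cycles of
  -- σ_π of length 2m.  Witnessed by a list of one representative per cycle
  -- together with the half-length of its cycle.
  Profile : List ℕ → Set
  Profile ps = Σ (List (Sym A × ℕ)) λ reps →
      All (λ r → Canonical (proj₁ r) × CycleLen (proj₁ r) (2 * proj₂ r)) reps
    × (∀ x → Canonical x → Any (λ r → SameCycle (proj₁ r) x) reps)
    × AllPairs (λ r r′ → ¬ SameCycle (proj₁ r) (proj₁ r′)) reps
    × ps ↭ map proj₂ reps

data Marking : Set where
  _∣_ : ℕ → ℕ → Marking
  _⊙_ : ℕ → ℕ → Marking

module _ {A : Set} {n : ℕ} (π : LabPerm A n) where

  HasMarkedProfile : Marking → List ℕ → Set
  HasMarkedProfile (m ∣ a) p′ =
      CycleLen π (Lsym π) (2 * m)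
    × iter (σ π) (suc (2 * a)) (Lsym π) ≡ Rsym π
    × (∀ j → j < suc (2 * a) → iter (σ π) j (Lsym π) ≢ Rsym π)
    × Profile π (m ∷ p′)
  HasMarkedProfile (ml ⊙ mr) p′ =
      ¬ SameCycle π (Lsym π) (Rsym π)
    × CycleLen π (Lsym π) (2 * ml)
    × CycleLen π (Rsym π) (2 * mr)
    × Profile π (ml ∷ mr ∷ p′)

  FirstType : Set
  FirstType = ∃ λ m → ∃ λ a → ∃ λ p′ → HasMarkedProfile (m ∣ a) p′

module Submission where

-- The interval diagram of π₁ · π₂ is the diagrams of π₁ and π₂ glued
-- at the hinges R₁ (of π₁) and L₂ (of π₂): σ follows σ_π₁ on the symbols of
-- π₁ and σ_π₂ on those of π₂, except that the step into R₁ now goes through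
-- the formerly identified symbol e₁ = (last top letter of π₁)^in on to L₂,
-- and the step into L₂ through e₂ = (first bottom letter of π₂)^out on to R₁.
-- So the cycles of R₁ and L₂, of lengths 2r and 2l, merge into one cycle of
-- length 2(r + l + 1), every other cycle survives, L = L₁ and R = R₂; the
-- four cases (i)-(iv) are read off from this.  Conversely, a cycle through
-- L and R must pass through both hinges, so L₁, R₁ and L₂, R₂ share cycles,
-- and such markings are of the first type since σ alternates out/in symbols.

open import Defs
open import Data.Nat using (ℕ; suc; _+_)
open import Data.List using (List; []; _∷_; _++_)
open import Data.Product using (_×_)
open import Function.Bundles using (_⇔_)

open import Data.Nat as ℕ using (zero; _*_; _<_; _≤_; _∸_; z≤n; z<s; s≤s; >-nonZero)
import Data.Nat.Properties as ℕP
open import Data.Nat.DivMod using (_%_; _/_; m%n<n; m≡m%n+[m/n]*n)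
open import Data.Nat.Tactic.RingSolver using (solve-∀)
open import Data.Fin using (zero; suc; toℕ; fromℕ; inject₁)
import Data.Fin.Properties as FinP
open import Data.Bool using (Bool; true; false; not)
open import Data.Bool.Properties using (not-involutive; not-¬)
open import Data.Empty using (⊥; ⊥-elim)
open import Data.Unit using (⊤; tt)
open import Data.Sum using (_⊎_; inj₁; inj₂)
open import Data.Product using (Σ; ∃; _,_; proj₁; proj₂; uncurry)
open import Data.List using (map)
open import Data.List.Membership.Propositional using (find)
open import Data.List.Membership.Propositional.Properties using (∈-∃++)
open import Data.List.Relation.Unary.All as All using (All; []; _∷_)
open import Data.List.Relation.Unary.Any using (Any; here; there)
open import Data.List.Relation.Unary.AllPairs using (AllPairs; []; _∷_)
import Data.List.Relation.Unary.All.Properties as Allₚ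
import Data.List.Relation.Unary.Any.Properties as Anyₚ
import Data.List.Relation.Unary.AllPairs.Properties as AllPairsₚ
open import Data.List.Relation.Binary.Permutation.Propositional
  using (_↭_; ↭-refl; ↭-sym; ↭-trans; ↭-reflexive; prep; swap; module PermutationReasoning)
import Data.List.Relation.Binary.Permutation.Propositional.Properties as ↭ₚ
import Data.List.Properties as Listₚ
open import Function.Bundles using (Inverse; Injection; mk⇔)
open import Function.Properties.Inverse using (↔⇒↣)
open import Relation.Binary.PropositionalEquality
open import Relation.Binary.Definitions using (DecidableEquality; tri<; tri≈; tri>)
open import Relation.Nullary using (¬_; yes; no; Dec)

leastBelow : (P : ℕ → Set) → (∀ j → Dec (P j)) → ∀ k →
  (∀ j → j < k → ¬ P j) ⊎ (Σ ℕ λ h → h < k × P h × (∀ j → j < h → ¬ P j))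
leastBelow P P? zero = inj₁ (λ j ())
leastBelow P P? (suc k) with leastBelow P P? k
... | inj₂ (h , h<k , Ph , least) = inj₂ (h , ℕP.m<n⇒m<1+n h<k , Ph , least)
... | inj₁ none with P? k
...   | yes Pk = inj₂ (k , ℕP.n<1+n k , Pk , none)
...   | no ¬Pk = inj₁ λ j j<1+k → below j (ℕP.m<1+n⇒m<n∨m≡n j<1+k)
  where
  below : ∀ j → j < k ⊎ j ≡ k → ¬ P j
  below j (inj₁ j<k) = none j j<k
  below j (inj₂ refl) = ¬Pk

belowOrAbove : ∀ a j → j < a ⊎ Σ ℕ λ i → j ≡ i + a
belowOrAbove a j with ℕP.<-cmp j a
... | tri< j<a _ _ = inj₁ j<a
... | tri≈ _ refl _ = inj₂ (0 , refl)
... | tri> _ _ j>a = inj₂ (j ∸ a , sym (ℕP.m∸n+n≡m (ℕP.<⇒≤ j>a)))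

allPairs-remove : ∀ {A : Set} {R : A → A → Set} pre {y post} → AllPairs R (pre ++ y ∷ post) →
  AllPairs R (pre ++ post) × All (λ x → R x y) pre × All (R y) post
allPairs-remove [] (y-rel ∷ rest) = rest , [] , y-rel
allPairs-remove (x ∷ pre) (x-rel ∷ rest) with allPairs-remove pre rest | Allₚ.++⁻ pre x-rel
... | rest′ , pre-y , y-post | x-pre , x-y ∷ x-post =
  Allₚ.++⁺ x-pre x-post ∷ rest′ , x-y ∷ pre-y , y-post

↭-removeMapped : ∀ {A B : Set} (g : A → B) pre {y post x xs} →
  x ∷ xs ↭ map g (pre ++ y ∷ post) → g y ≡ x → xs ↭ map g (pre ++ post)
↭-removeMapped g pre {y} {post} {x} perm gy≡x = ↭ₚ.drop-∷ (↭-trans perm (begin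
  map g (pre ++ y ∷ post)          ≡⟨ Listₚ.map-++ g pre (y ∷ post) ⟩
  map g pre ++ g y ∷ map g post    ↭⟨ ↭ₚ.shift (g y) (map g pre) (map g post) ⟩
  g y ∷ map g pre ++ map g post    ≡⟨ cong₂ _∷_ gy≡x (sym (Listₚ.map-++ g pre post)) ⟩
  x ∷ map g (pre ++ post)          ∎))
  where open PermutationReasoning

-- Orbits of an endofunction f.  The notions below are those of Defs
-- (CycleLen, SameCycle, Profile) for an arbitrary f and an arbitrary
-- predicate C selecting the points that matter.
module Orbit {X : Set} (f : X → X) where

  CycleLength : X → ℕ → Set
  CycleLength x k = 0 < k × iter f k x ≡ x × (∀ j → 0 < j → j < k → iter f j x ≢ x)

  Reaches : X → X → Set
  Reaches x y = ∃ λ k → iter f k x ≡ y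

  ProfileOf : (X → Set) → List ℕ → Set
  ProfileOf C ps = Σ (List (X × ℕ)) λ reps →
      All (λ r → C (proj₁ r) × CycleLength (proj₁ r) (2 * proj₂ r)) reps
    × (∀ x → C x → Any (λ r → Reaches (proj₁ r) x) reps)
    × AllPairs (λ r r′ → ¬ Reaches (proj₁ r) (proj₁ r′)) reps
    × ps ↭ map proj₂ reps

  profile-↭ : ∀ {C ps ps′} → ProfileOf C ps → ps′ ↭ ps → ProfileOf C ps′
  profile-↭ (reps , ok , covers , distinct , perm) ps′↭ps = reps , ok , covers , distinct , ↭-trans ps′↭ps perm

  iter-+ : ∀ j k x → iter f (j + k) x ≡ iter f j (iter f k x)
  iter-+ zero k x = refl
  iter-+ (suc j) k x = cong f (iter-+ j k x)

  iter-swap : ∀ j k x → iter f j (iter f k x) ≡ iter f k (iter f j x)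
  iter-swap j k x = begin
    iter f j (iter f k x) ≡⟨ iter-+ j k x ⟨
    iter f (j + k) x      ≡⟨ cong (λ i → iter f i x) (ℕP.+-comm j k) ⟩
    iter f (k + j) x      ≡⟨ iter-+ k j x ⟩
    iter f k (iter f j x) ∎
    where open ≡-Reasoning

  iter-invariant : (I : X → Set) → (∀ z → I z → I (f z)) → ∀ k z → I z → I (iter f k z)
  iter-invariant I step zero z Iz = Iz
  iter-invariant I step (suc k) z Iz = step _ (iter-invariant I step k z Iz)

  iter-periodic : ∀ {p x} → iter f p x ≡ x → ∀ q → iter f (q * p) x ≡ x
  iter-periodic e zero = refl
  iter-periodic {p} {x} e (suc q) =
    trans (iter-+ p (q * p) x) (trans (cong (iter f p) (iter-periodic e q)) e)

  iter-mod : ∀ {p x} → iter f p x ≡ x → 0 < p →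
             ∀ k → Σ ℕ λ k′ → k′ < p × iter f k x ≡ iter f k′ x
  iter-mod {p} {x} e p>0 k = k % p , m%n<n k p , (begin
    iter f k x                             ≡⟨ cong (λ i → iter f i x) (m≡m%n+[m/n]*n k p) ⟩
    iter f (k % p + (k / p) * p) x         ≡⟨ iter-+ (k % p) ((k / p) * p) x ⟩
    iter f (k % p) (iter f ((k / p) * p) x) ≡⟨ cong (iter f (k % p)) (iter-periodic e (k / p)) ⟩
    iter f (k % p) x                       ∎)
    where
    open ≡-Reasoning
    instance _ = >-nonZero p>0

  reaches-trans : ∀ {x y z} → Reaches x y → Reaches y z → Reaches x z
  reaches-trans {x} (k , e) (l , e′) = l + k , trans (iter-+ l k x) (trans (cong (iter f l) e) e′)

  reaches-sym : ∀ {p x y} → CycleLength x p → Reaches x y → Reaches y x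
  reaches-sym {p} {x} (p>0 , e , _) (k , refl) with iter-mod e p>0 k
  ... | k′ , k′<p , e′ = p ∸ k′ , (begin
    iter f (p ∸ k′) (iter f k x)  ≡⟨ cong (iter f (p ∸ k′)) e′ ⟩
    iter f (p ∸ k′) (iter f k′ x) ≡⟨ iter-+ (p ∸ k′) k′ x ⟨
    iter f (p ∸ k′ + k′) x        ≡⟨ cong (λ i → iter f i x) (ℕP.m∸n+n≡m (ℕP.<⇒≤ k′<p)) ⟩
    iter f p x                    ≡⟨ e ⟩
    x                             ∎)
    where open ≡-Reasoning

  period-transfer : ∀ j k {x y} → iter f k y ≡ x → iter f j y ≡ y → iter f j x ≡ x
  period-transfer j k refl e = trans (iter-swap j k _) (cong (iter f k) e)

  cycleLength-along : ∀ {p x y} → CycleLength x p → Reaches x y → CycleLength y p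
  cycleLength-along {p} cl@(p>0 , e , minimal) r@(k , ek) with reaches-sym cl r
  ... | k′ , ek′ = p>0 , period-transfer p k ek e ,
        λ j j>0 j<p ej → minimal j j>0 j<p (period-transfer j k′ ek′ ej)

  cycleLength-unique : ∀ {p q x} → CycleLength x p → CycleLength x q → p ≡ q
  cycleLength-unique {p} {q} (p>0 , ep , mp) (q>0 , eq , mq) with ℕP.<-cmp p q
  ... | tri< p<q _ _ = ⊥-elim (mq p p>0 p<q ep)
  ... | tri≈ _ p≡q _ = p≡q
  ... | tri> _ _ p>q = ⊥-elim (mp q q>0 p>q eq)

  evenCycle-notFixed : ∀ {m x} → CycleLength x (2 * m) → f x ≢ x
  evenCycle-notFixed {zero} (() , _)
  evenCycle-notFixed {suc m} (_ , _ , minimal) =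
    minimal 1 z<s (s≤s (ℕP.≤-trans (s≤s z≤n) (ℕP.m≤n+m (suc (m + 0)) m)))

  firstVisit<length : ∀ {p x y d} → CycleLength x p → iter f d x ≡ y →
                      (∀ j → j < d → iter f j x ≢ y) → d < p
  firstVisit<length {p} {x} {y} {d} (p>0 , e , _) ed earlier with iter-mod e p>0 d
  ... | d′ , d′<p , e′ with ℕP.<-cmp d p
  ...   | tri< d<p _ _ = d<p
  ...   | tri≈ _ refl _ = ⊥-elim (earlier d′ d′<p (trans (sym e′) ed))
  ...   | tri> _ _ d>p = ⊥-elim (earlier d′ (ℕP.<-trans d′<p d>p) (trans (sym e′) ed))

  module WithDecidableEquality (_≟_ : DecidableEquality X) where

    firstVisit : ∀ {x y k} → iter f k x ≡ y →
                 Σ ℕ λ d → iter f d x ≡ y × (∀ j → j < d → iter f j x ≢ y)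
    firstVisit {x} {y} {k} e with leastBelow (λ j → iter f j x ≡ y) (λ j → iter f j x ≟ y) (suc k)
    ... | inj₁ none = ⊥-elim (none k (ℕP.n<1+n k) e)
    ... | inj₂ (d , _ , ed , earlier) = d , ed , earlier

    firstReturn : ∀ {x t} → iter f (suc t) x ≡ x → Σ ℕ λ p → CycleLength x p
    firstReturn {x} {t} e
      with leastBelow (λ j → iter f (suc j) x ≡ x) (λ j → iter f (suc j) x ≟ x) (suc t)
    ... | inj₁ none = ⊥-elim (none t (ℕP.n<1+n t) e)
    ... | inj₂ (h , _ , eh , earlier) = suc h , z<s , eh , minimal
      where
      minimal : ∀ j → 0 < j → j < suc h → iter f j x ≢ x
      minimal (suc j) _ (s≤s j<h) = earlier j j<h

  module RemoveCycle (C : X → Set) (S : X) where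

    Avoids : X → Set
    Avoids x = ∀ k → iter f k x ≢ S

    RepCycle : X × ℕ → Set
    RepCycle ρ = C (proj₁ ρ) × CycleLength (proj₁ ρ) (2 * proj₂ ρ)

    OtherCycle : X × ℕ → Set
    OtherCycle ρ = RepCycle ρ × Avoids (proj₁ ρ)

    avoidsOf : ∀ {ρ₀} → Reaches S ρ₀ → ∀ {ρ} → RepCycle ρ →
               ¬ Reaches (proj₁ ρ) ρ₀ → OtherCycle ρ
    avoidsOf S→ρ₀ ok ¬ρ→ρ₀ = ok , λ k e → ¬ρ→ρ₀ (reaches-trans (k , e) S→ρ₀)

    removeCycle : ∀ {r ps} → C S → CycleLength S (2 * r) → ProfileOf C (r ∷ ps) →
      Σ (List (X × ℕ)) λ rest → ps ↭ map proj₂ rest × All OtherCycle rest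
        × AllPairs (λ ρ ρ′ → ¬ Reaches (proj₁ ρ) (proj₁ ρ′)) rest
        × (∀ x → C x → Reaches S x ⊎ Any (λ ρ → Reaches (proj₁ ρ) x) rest)
    removeCycle {r} {ps} cS clS (reps , reps-ok , covers , distinct , perm)
      with find (covers S cS)
    ... | ρ₀ , ρ₀∈ , ρ₀→S with ∈-∃++ ρ₀∈
    ... | pre , post , refl with Allₚ.++⁻ pre reps-ok | allPairs-remove pre distinct
    ... | pre-ok , ρ₀-ok ∷ post-ok | distinct′ , pre↛ρ₀ , ρ₀↛post =
          pre ++ post , ↭-removeMapped proj₂ pre perm ρ₀-length ,
          Allₚ.++⁺ (others pre-ok pre↛ρ₀) (others post-ok post↛ρ₀) , distinct′ , covers′
      where
      S→ρ₀ : Reaches S (proj₁ ρ₀)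
      S→ρ₀ = reaches-sym (proj₂ ρ₀-ok) ρ₀→S
      -- the cycle of ρ₀ is the cycle of S, hence has the same length
      ρ₀-length : proj₂ ρ₀ ≡ r
      ρ₀-length = ℕP.*-cancelˡ-≡ (proj₂ ρ₀) r 2
        (cycleLength-unique (cycleLength-along (proj₂ ρ₀-ok) ρ₀→S) clS)
      post↛ρ₀ : All (λ ρ → ¬ Reaches (proj₁ ρ) (proj₁ ρ₀)) post
      post↛ρ₀ = All.zipWith (λ { ((_ , clρ) , ¬ρ₀→ρ) ρ→ρ₀ → ¬ρ₀→ρ (reaches-sym clρ ρ→ρ₀) })
                  (post-ok , ρ₀↛post)
      others : ∀ {xs} → All RepCycle xs → All (λ ρ → ¬ Reaches (proj₁ ρ) (proj₁ ρ₀)) xs →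
               All OtherCycle xs
      others ok ¬reach = All.zipWith (λ {ρ} (okρ , ¬r) → avoidsOf S→ρ₀ {ρ} okρ ¬r) (ok , ¬reach)
      covers′ : ∀ x → C x → Reaches S x ⊎ Any (λ ρ → Reaches (proj₁ ρ) x) (pre ++ post)
      covers′ x cx with Anyₚ.++⁻ pre (covers x cx)
      ... | inj₁ in-pre = inj₂ (Anyₚ.++⁺ˡ in-pre)
      ... | inj₂ (here ρ₀→x) = inj₁ (reaches-trans S→ρ₀ ρ₀→x)
      ... | inj₂ (there in-post) = inj₂ (Anyₚ.++⁺ʳ pre in-post)

-- A system f on X
-- contains copies ι₁ X₁ and ι₂ X₂ of the (relevant, C-) points of f₁ and
-- f₂ plus two bridge points e₁ e₂; f copies f₁ and f₂, except that the
-- step of f₁ into the hinge S₁ is rerouted through e₁ to ι₂ S₂, and the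
-- step of f₂ into the hinge S₂ through e₂ to ι₁ S₁.
record Gluing : Set₁ where
  field
    X₁ X₂ X : Set
    f₁ : X₁ → X₁
    f₂ : X₂ → X₂
    f  : X → X
    C₁ : X₁ → Set
    C₂ : X₂ → Set
    C  : X → Set
    ι₁ : X₁ → X
    ι₂ : X₂ → X
    S₁ : X₁
    S₂ : X₂
    e₁ e₂ : X
    ι₁-inj : ∀ {x y} → ι₁ x ≡ ι₁ y → x ≡ y
    ι₂-inj : ∀ {x y} → ι₂ x ≡ ι₂ y → x ≡ y
    ι₁≢ι₂ : ∀ x y → ι₁ x ≢ ι₂ y
    e₁≢ι₁ : ∀ x → C₁ x → e₁ ≢ ι₁ x
    e₂≢ι₂ : ∀ y → C₂ y → e₂ ≢ ι₂ y
    e₁≢ι₂ : ∀ y → e₁ ≢ ι₂ y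
    e₂≢ι₁ : ∀ x → e₂ ≢ ι₁ x
    C₁-closed : ∀ x → C₁ x → C₁ (f₁ x)
    C₂-closed : ∀ y → C₂ y → C₂ (f₂ y)
    C₁S₁ : C₁ S₁
    C₂S₂ : C₂ S₂
    step₁ : ∀ x → C₁ x → f₁ x ≢ S₁ → f (ι₁ x) ≡ ι₁ (f₁ x)
    hit₁ : ∀ x → C₁ x → f₁ x ≡ S₁ → f (ι₁ x) ≡ e₁
    bridge₁ : f e₁ ≡ ι₂ S₂
    step₂ : ∀ y → C₂ y → f₂ y ≢ S₂ → f (ι₂ y) ≡ ι₂ (f₂ y)
    hit₂ : ∀ y → C₂ y → f₂ y ≡ S₂ → f (ι₂ y) ≡ e₂
    bridge₂ : f e₂ ≡ ι₁ S₁
    C-ι₁ : ∀ x → C₁ x → C (ι₁ x)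
    C-ι₂ : ∀ y → C₂ y → C (ι₂ y)
    C-cases : ∀ z → C z → (Σ X₁ λ x → C₁ x × z ≡ ι₁ x) ⊎ (Σ X₂ λ y → C₂ y × z ≡ ι₂ y)
                        ⊎ z ≡ e₁ ⊎ z ≡ e₂
    _≟₁_ : DecidableEquality X₁
    _≟₂_ : DecidableEquality X₂

swapGluing : Gluing → Gluing
swapGluing g = record
  { X₁ = X₂ ; X₂ = X₁ ; X = X ; f₁ = f₂ ; f₂ = f₁ ; f = f ; C₁ = C₂ ; C₂ = C₁ ; C = C
  ; ι₁ = ι₂ ; ι₂ = ι₁ ; S₁ = S₂ ; S₂ = S₁ ; e₁ = e₂ ; e₂ = e₁
  ; ι₁-inj = ι₂-inj ; ι₂-inj = ι₁-inj ; ι₁≢ι₂ = λ y x e → ι₁≢ι₂ x y (sym e)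
  ; e₁≢ι₁ = e₂≢ι₂ ; e₂≢ι₂ = e₁≢ι₁ ; e₁≢ι₂ = e₂≢ι₁ ; e₂≢ι₁ = e₁≢ι₂
  ; C₁-closed = C₂-closed ; C₂-closed = C₁-closed ; C₁S₁ = C₂S₂ ; C₂S₂ = C₁S₁
  ; step₁ = step₂ ; hit₁ = hit₂ ; bridge₁ = bridge₂
  ; step₂ = step₁ ; hit₂ = hit₁ ; bridge₂ = bridge₁
  ; C-ι₁ = C-ι₂ ; C-ι₂ = C-ι₁
  ; C-cases = λ z cz → swapCases (C-cases z cz)
  ; _≟₁_ = _≟₂_ ; _≟₂_ = _≟₁_ }
  where
  open Gluing g
  swapCases : ∀ {P Q R S : Set} → P ⊎ Q ⊎ R ⊎ S → Q ⊎ P ⊎ S ⊎ R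
  swapCases (inj₁ p) = inj₂ (inj₁ p)
  swapCases (inj₂ (inj₁ q)) = inj₁ q
  swapCases (inj₂ (inj₂ (inj₁ r))) = inj₂ (inj₂ (inj₂ r))
  swapCases (inj₂ (inj₂ (inj₂ s))) = inj₂ (inj₂ (inj₁ s))

-- How orbits of f look from side 1 (side 2 is the same statement for the
-- swapped gluing).
module GluingSide (g : Gluing) where
  open Gluing g
  module O₁ = Orbit f₁
  module O = Orbit f
  open O using (CycleLength; Reaches)

  C₁-iter : ∀ k x → C₁ x → C₁ (iter f₁ k x)
  C₁-iter = O₁.iter-invariant C₁ C₁-closed

  MissesFor : X₁ → ℕ → Set
  MissesFor x k = ∀ j → j < k → iter f₁ (suc j) x ≢ S₁

  FirstHitAt : X₁ → ℕ → Set
  FirstHitAt x h = MissesFor x h × iter f₁ (suc h) x ≡ S₁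

  missesOrHits : ∀ x k → MissesFor x k ⊎ Σ ℕ λ h → h < k × FirstHitAt x h
  missesOrHits x k
    with leastBelow (λ j → iter f₁ (suc j) x ≡ S₁) (λ j → iter f₁ (suc j) x ≟₁ S₁) k
  ... | inj₁ none = inj₁ none
  ... | inj₂ (h , h<k , hit , earlier) = inj₂ (h , h<k , earlier , hit)

  Avoids₁ : X₁ → Set
  Avoids₁ = O₁.RemoveCycle.Avoids C₁ S₁

  walk : ∀ {x} k → C₁ x → MissesFor x k → iter f k (ι₁ x) ≡ ι₁ (iter f₁ k x)
  walk zero cx _ = refl
  walk {x} (suc k) cx misses =
    trans (cong f (walk k cx (λ j j<k → misses j (ℕP.m<n⇒m<1+n j<k))))
          (step₁ _ (C₁-iter k x cx) (misses k (ℕP.n<1+n k)))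

  reachBridge : ∀ {x h} → C₁ x → FirstHitAt x h → iter f (suc h) (ι₁ x) ≡ e₁
  reachBridge {x} {h} cx (misses , hit) =
    trans (cong f (walk h cx misses)) (hit₁ _ (C₁-iter h x cx) hit)

  crossOver : ∀ {x h} d → C₁ x → FirstHitAt x h →
              iter f (d + suc (suc h)) (ι₁ x) ≡ iter f d (ι₂ S₂)
  crossOver d cx fh =
    trans (O.iter-+ d _ _) (cong (iter f d) (trans (cong f (reachBridge cx fh)) bridge₁))

  mustHit : ∀ {x q y} → C₁ x → iter f q (ι₁ x) ≡ ι₂ y → Σ ℕ λ h → FirstHitAt x h
  mustHit {x} {q} cx e with missesOrHits x q
  ... | inj₁ misses = ⊥-elim (ι₁≢ι₂ _ _ (trans (sym (walk q cx misses)) e))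
  ... | inj₂ (h , _ , fh) = h , fh

  missesForever : ∀ {x p} → C₁ x → CycleLength (ι₁ x) p → MissesFor x p → Avoids₁ x
  missesForever {p = zero} _ (() , _) _
  missesForever {x} {suc p} cx (_ , back , _) misses k = avoid (O₁.iter-mod period z<s k)
    where
    period : iter f₁ (suc p) x ≡ x
    period = ι₁-inj (trans (sym (walk (suc p) cx misses)) back)
    avoid : (Σ ℕ λ k′ → k′ < suc p × iter f₁ k x ≡ iter f₁ k′ x) → iter f₁ k x ≢ S₁
    avoid (zero , _ , e′) e = misses p (ℕP.n<1+n p) (trans period (trans (sym e′) e))
    avoid (suc j , s≤s j<p , e′) e = misses j (ℕP.m<n⇒m<1+n j<p) (trans (sym e′) e)

  walkAvoiding : ∀ {x} → C₁ x → Avoids₁ x → ∀ k → iter f k (ι₁ x) ≡ ι₁ (iter f₁ k x)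
  walkAvoiding cx av k = walk k cx (λ j _ → av (suc j))

  cycleLength-embed : ∀ {x p} → C₁ x → Avoids₁ x → O₁.CycleLength x p → CycleLength (ι₁ x) p
  cycleLength-embed {x} {p} cx av (p>0 , e , minimal) =
    p>0 , trans (walkAvoiding cx av p) (cong ι₁ e) ,
    λ j j>0 j<p ej → minimal j j>0 j<p (ι₁-inj (trans (sym (walkAvoiding cx av j)) ej))

  cycleLength-restrict : ∀ {x p} → C₁ x → Avoids₁ x → CycleLength (ι₁ x) p → O₁.CycleLength x p
  cycleLength-restrict {x} {p} cx av (p>0 , e , minimal) =
    p>0 , ι₁-inj (trans (sym (walkAvoiding cx av p)) e) ,
    λ j j>0 j<p ej → minimal j j>0 j<p (trans (walkAvoiding cx av j) (cong ι₁ ej))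

  reaches-embed : ∀ {x y} → C₁ x → Avoids₁ x → O₁.Reaches x y → Reaches (ι₁ x) (ι₁ y)
  reaches-embed cx av (k , e) = k , trans (walkAvoiding cx av k) (cong ι₁ e)

  reaches-restrict : ∀ {x y} → C₁ x → Avoids₁ x → Reaches (ι₁ x) (ι₁ y) → O₁.Reaches x y
  reaches-restrict cx av (k , e) = k , ι₁-inj (trans (sym (walkAvoiding cx av k)) e)

  avoiding-stays : ∀ {x z} → C₁ x → Avoids₁ x → Reaches (ι₁ x) z →
                   Σ X₁ λ x′ → C₁ x′ × z ≡ ι₁ x′
  avoiding-stays {x} cx av (k , refl) = iter f₁ k x , C₁-iter k x cx , walkAvoiding cx av k

  avoiding↛ι₂ : ∀ {x y} → C₁ x → Avoids₁ x → ¬ Reaches (ι₁ x) (ι₂ y)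
  avoiding↛ι₂ cx av r with avoiding-stays cx av r
  ... | x′ , _ , e = ι₁≢ι₂ x′ _ (sym e)

  avoiding↛hinge : ∀ {x} → C₁ x → Avoids₁ x → ¬ Reaches (ι₁ x) (ι₁ S₁)
  avoiding↛hinge cx av r with reaches-restrict cx av r
  ... | k , e = av k e

  hingeFirstHit : ∀ {p} → O₁.CycleLength S₁ (suc p) → FirstHitAt S₁ p
  hingeFirstHit (_ , e , minimal) = (λ j j<p → minimal (suc j) z<s (s≤s j<p)) , e

  hingeWalk : ∀ {P} → O₁.CycleLength S₁ P → ∀ k → k < P → iter f k (ι₁ S₁) ≡ ι₁ (iter f₁ k S₁)
  hingeWalk (_ , _ , minimal) k k<P =
    walk k C₁S₁ (λ j j<k → minimal (suc j) z<s (ℕP.≤-<-trans j<k k<P))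

  hingeCycle-embed : ∀ {P x} → O₁.CycleLength S₁ P → O₁.Reaches S₁ x → Reaches (ι₁ S₁) (ι₁ x)
  hingeCycle-embed {P} {x} cl@(P>0 , e , _) (k , ek) with O₁.iter-mod e P>0 k
  ... | k′ , k′<P , e′ = k′ , trans (hingeWalk cl k′ k′<P) (cong ι₁ (trans (sym e′) ek))

  Rep : X × ℕ → Set
  Rep ρ = C (proj₁ ρ) × CycleLength (proj₁ ρ) (2 * proj₂ ρ)

  Distinct : X × ℕ → X × ℕ → Set
  Distinct ρ ρ′ = ¬ Reaches (proj₁ ρ) (proj₁ ρ′)

  OtherCycle₁ : X₁ × ℕ → Set
  OtherCycle₁ = O₁.RemoveCycle.OtherCycle C₁ S₁

  embed : X₁ × ℕ → X × ℕ
  embed ρ = ι₁ (proj₁ ρ) , proj₂ ρ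

  embed-all : ∀ {P : X × ℕ → Set} {rest} → (∀ {ρ} → OtherCycle₁ ρ → P (embed ρ)) →
              All OtherCycle₁ rest → All P (map embed rest)
  embed-all h others = Allₚ.map⁺ (All.map h others)

  embed-rep : ∀ {ρ} → OtherCycle₁ ρ → Rep (embed ρ)
  embed-rep ((cx , cl) , av) = C-ι₁ _ cx , cycleLength-embed cx av cl

  embed-distinct : ∀ {ρ ρ′} → OtherCycle₁ ρ → ¬ O₁.Reaches (proj₁ ρ) (proj₁ ρ′) →
                   Distinct (embed ρ) (embed ρ′)
  embed-distinct ((cx , _) , av) ¬r r = ¬r (reaches-restrict cx av r)

  embed-covers : ∀ {x rest} → All OtherCycle₁ rest →
                 Any (λ ρ → O₁.Reaches (proj₁ ρ) x) rest →
                 Any (λ ρ → Reaches (proj₁ ρ) (ι₁ x)) (map embed rest)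
  embed-covers (((cx , _) , av) ∷ _) (here r) = here (reaches-embed cx av r)
  embed-covers (_ ∷ others) (there a) = there (embed-covers others a)

  embed-allPairs : ∀ {rest} → All OtherCycle₁ rest →
                   AllPairs (λ ρ ρ′ → ¬ O₁.Reaches (proj₁ ρ) (proj₁ ρ′)) rest →
                   AllPairs Distinct (map embed rest)
  embed-allPairs [] [] = []
  embed-allPairs {ρ ∷ _} (o ∷ os) (d ∷ ds) =
    Allₚ.map⁺ (All.map (λ {ρ′} → embed-distinct {ρ} {ρ′} o) d) ∷ embed-allPairs os ds

  embed-unreached : ∀ {z p} → CycleLength z p → (∀ {x} → C₁ x → Avoids₁ x → ¬ Reaches (ι₁ x) z) →
                    ∀ {ρ} → OtherCycle₁ ρ → Distinct (z , p) (embed ρ)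
  embed-unreached clz unreached ((cx , _) , av) r = unreached cx av (O.reaches-sym clz r)

module Glued (g : Gluing) where
  open Gluing g
  module Side₁ = GluingSide g
  module Side₂ = GluingSide (swapGluing g)
  module O₁ = Orbit f₁
  module O₂ = Orbit f₂
  module O = Orbit f
  open O using (CycleLength; Reaches; ProfileOf; reaches-trans)
  open Side₁ using (Rep; Distinct)

  -- from one hinge to the other: once round the hinge cycle, then across the bridge
  hinge₁→hinge₂ : ∀ {p₁} → O₁.CycleLength S₁ (suc p₁) → iter f (suc (suc p₁)) (ι₁ S₁) ≡ ι₂ S₂
  hinge₁→hinge₂ cl = Side₁.crossOver 0 C₁S₁ (Side₁.hingeFirstHit cl)

  hinge₂→hinge₁ : ∀ {p₂} → O₂.CycleLength S₂ (suc p₂) → iter f (suc (suc p₂)) (ι₂ S₂) ≡ ι₁ S₁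
  hinge₂→hinge₁ cl = Side₂.crossOver 0 C₂S₂ (Side₂.hingeFirstHit cl)

  -- The glued cycle: S₁'s cycle, the bridge e₁, S₂'s cycle, the bridge e₂.
  gluedCycle′ : ∀ {p₁ p₂} → O₁.CycleLength S₁ (suc p₁) → O₂.CycleLength S₂ (suc p₂) →
                CycleLength (ι₁ S₁) (suc (suc p₂) + suc (suc p₁))
  gluedCycle′ {p₁} {p₂} cl₁ cl₂ = z<s , closes , noEarlyReturn
    where
    T : ℕ
    T = suc (suc p₂) + suc (suc p₁)
    closes : iter f T (ι₁ S₁) ≡ ι₁ S₁
    closes = trans (O.iter-+ (suc (suc p₂)) (suc (suc p₁)) (ι₁ S₁))
                   (trans (cong (iter f (suc (suc p₂))) (hinge₁→hinge₂ cl₁)) (hinge₂→hinge₁ cl₂))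
    viaSide₂ : ∀ i → iter f (suc i + suc p₁) (ι₁ S₁) ≡ iter f i (ι₂ S₂)
    viaSide₂ i = trans (cong (λ k → iter f k (ι₁ S₁)) (sym (ℕP.+-suc i (suc p₁))))
                       (Side₁.crossOver i C₁S₁ (Side₁.hingeFirstHit cl₁))
    tooLate : ∀ t → T ≤ suc (suc t + suc p₂) + suc p₁
    tooLate t = ℕP.≤-trans (ℕP.m≤m+n T t) (ℕP.≤-reflexive (arith t p₁ p₂))
      where
      arith : ∀ t p₁ p₂ → suc (suc p₂) + suc (suc p₁) + t ≡ suc (suc t + suc p₂) + suc p₁
      arith = solve-∀
    noEarlyReturn : ∀ j → 0 < j → j < T → iter f j (ι₁ S₁) ≢ ι₁ S₁
    noEarlyReturn j j>0 j<T eq with belowOrAbove (suc p₁) j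
    ... | inj₁ j<P₁ = proj₂ (proj₂ cl₁) j j>0 j<P₁
                        (ι₁-inj (trans (sym (Side₁.hingeWalk cl₁ j j<P₁)) eq))
    ... | inj₂ (zero , refl) =
          e₁≢ι₁ S₁ C₁S₁ (trans (sym (Side₁.reachBridge C₁S₁ (Side₁.hingeFirstHit cl₁))) eq)
    ... | inj₂ (suc i , refl) with belowOrAbove (suc p₂) i
    ...   | inj₁ i<P₂ = ι₁≢ι₂ S₁ _ (trans (sym eq) (trans (viaSide₂ i) (Side₂.hingeWalk cl₂ i i<P₂)))
    ...   | inj₂ (zero , refl) = e₂≢ι₁ S₁ (trans (sym (trans (viaSide₂ (suc p₂))
                                   (Side₂.reachBridge C₂S₂ (Side₂.hingeFirstHit cl₂)))) eq)
    ...   | inj₂ (suc t , refl) = ℕP.<-irrefl refl (ℕP.<-≤-trans j<T (tooLate t))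

  gluedCycle : ∀ {r l} → O₁.CycleLength S₁ (2 * r) → O₂.CycleLength S₂ (2 * l) →
               CycleLength (ι₁ S₁) (2 * (r + l + 1))
  gluedCycle {zero} (() , _)
  gluedCycle {suc r} {zero} _ (() , _)
  gluedCycle {suc r} {suc l} cl₁ cl₂ = subst (CycleLength (ι₁ S₁)) (arith r l) (gluedCycle′ cl₁ cl₂)
    where
    arith : ∀ r l → suc (suc (l + suc (l + 0))) + suc (suc (r + suc (r + 0))) ≡ 2 * (suc r + suc l + 1)
    arith = solve-∀

  hinge₁↝hinge₂ : ∀ {P₁} → O₁.CycleLength S₁ P₁ → Reaches (ι₁ S₁) (ι₂ S₂)
  hinge₁↝hinge₂ {zero} (() , _)
  hinge₁↝hinge₂ {suc p₁} cl = suc (suc p₁) , hinge₁→hinge₂ cl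

  onGlued-ι₂ : ∀ {P₁ P₂ y} → O₁.CycleLength S₁ P₁ → O₂.CycleLength S₂ P₂ → O₂.Reaches S₂ y →
               Reaches (ι₁ S₁) (ι₂ y)
  onGlued-ι₂ cl₁ cl₂ r = reaches-trans (hinge₁↝hinge₂ cl₁) (Side₂.hingeCycle-embed cl₂ r)

  onGlued-e₁ : ∀ {P₁} → O₁.CycleLength S₁ P₁ → Reaches (ι₁ S₁) e₁
  onGlued-e₁ {zero} (() , _)
  onGlued-e₁ {suc p} cl = suc p , Side₁.reachBridge C₁S₁ (Side₁.hingeFirstHit cl)

  onGlued-e₂ : ∀ {P₁ P₂} → O₁.CycleLength S₁ P₁ → O₂.CycleLength S₂ P₂ → Reaches (ι₁ S₁) e₂
  onGlued-e₂ {P₂ = zero} _ (() , _)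
  onGlued-e₂ {P₂ = suc p} cl₁ cl₂ =
    reaches-trans (hinge₁↝hinge₂ cl₁) (suc p , Side₂.reachBridge C₂S₂ (Side₂.hingeFirstHit cl₂))

  gluedCovers : ∀ {P₁ P₂ c rest₁ rest₂} → O₁.CycleLength S₁ P₁ → O₂.CycleLength S₂ P₂ →
    All Side₁.OtherCycle₁ rest₁ → All Side₂.OtherCycle₁ rest₂ →
    (∀ x → C₁ x → O₁.Reaches S₁ x ⊎ Any (λ ρ → O₁.Reaches (proj₁ ρ) x) rest₁) →
    (∀ y → C₂ y → O₂.Reaches S₂ y ⊎ Any (λ ρ → O₂.Reaches (proj₁ ρ) y) rest₂) →
    ∀ z → C z → Any (λ ρ → Reaches (proj₁ ρ) z)
                    ((ι₁ S₁ , c) ∷ map Side₁.embed rest₁ ++ map Side₂.embed rest₂)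
  gluedCovers {rest₁ = rest₁} cl₁ cl₂ others₁ others₂ covers₁ covers₂ z cz with C-cases z cz
  ... | inj₁ (x , cx , refl) with covers₁ x cx
  ...   | inj₁ r = here (Side₁.hingeCycle-embed cl₁ r)
  ...   | inj₂ a = there (Anyₚ.++⁺ˡ (Side₁.embed-covers others₁ a))
  gluedCovers {rest₁ = rest₁} cl₁ cl₂ others₁ others₂ covers₁ covers₂ z cz
    | inj₂ (inj₁ (y , cy , refl)) with covers₂ y cy
  ...   | inj₁ r = here (onGlued-ι₂ cl₁ cl₂ r)
  ...   | inj₂ a = there (Anyₚ.++⁺ʳ (map Side₁.embed rest₁) (Side₂.embed-covers others₂ a))
  gluedCovers cl₁ _ _ _ _ _ z cz | inj₂ (inj₂ (inj₁ refl)) = here (onGlued-e₁ cl₁)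
  gluedCovers cl₁ cl₂ _ _ _ _ z cz | inj₂ (inj₂ (inj₂ refl)) = here (onGlued-e₂ cl₁ cl₂)

  gluedProfile : ∀ {r l ps₁ ps₂} → O₁.CycleLength S₁ (2 * r) → O₂.CycleLength S₂ (2 * l) →
                 O₁.ProfileOf C₁ (r ∷ ps₁) → O₂.ProfileOf C₂ (l ∷ ps₂) →
                 ProfileOf C ((r + l + 1) ∷ ps₁ ++ ps₂)
  gluedProfile {r} {l} {ps₁} {ps₂} cl₁ cl₂ P₁ P₂
    with O₁.RemoveCycle.removeCycle C₁ S₁ {r} C₁S₁ cl₁ P₁
       | O₂.RemoveCycle.removeCycle C₂ S₂ {l} C₂S₂ cl₂ P₂
  ... | rest₁ , perm₁ , others₁ , distinct₁ , covers₁ | rest₂ , perm₂ , others₂ , distinct₂ , covers₂ =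
        glued ∷ reps ,
        (C-ι₁ S₁ C₁S₁ , glued-cycle) ∷ Allₚ.++⁺ (Side₁.embed-all (λ {ρ} → Side₁.embed-rep {ρ}) others₁)
                                                (Side₂.embed-all (λ {ρ} → Side₂.embed-rep {ρ}) others₂) ,
        gluedCovers cl₁ cl₂ others₁ others₂ covers₁ covers₂ ,
        glued-distinct ∷ AllPairsₚ.++⁺ (Side₁.embed-allPairs others₁ distinct₁)
                                       (Side₂.embed-allPairs others₂ distinct₂) sides-distinct ,
        perm
    where
    glued : X × ℕ
    glued = ι₁ S₁ , r + l + 1
    reps₁ : List (X × ℕ)
    reps₁ = map Side₁.embed rest₁
    reps₂ : List (X × ℕ)
    reps₂ = map Side₂.embed rest₂
    reps : List (X × ℕ)
    reps = reps₁ ++ reps₂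
    glued-cycle : CycleLength (ι₁ S₁) (2 * (r + l + 1))
    glued-cycle = gluedCycle {r} {l} cl₁ cl₂
    glued-distinct : All (Distinct glued) reps
    glued-distinct = Allₚ.++⁺
      (Side₁.embed-all (λ {ρ} → Side₁.embed-unreached glued-cycle Side₁.avoiding↛hinge {ρ}) others₁)
      (Side₂.embed-all (λ {ρ} → Side₂.embed-unreached glued-cycle Side₂.avoiding↛ι₂ {ρ}) others₂)
    sides-distinct : All (λ ρ → All (Distinct ρ) reps₂) reps₁
    sides-distinct =
      Side₁.embed-all (λ {ρ} ((cx , _) , av) →
        Side₂.embed-all (λ {ρ′} _ → Side₁.avoiding↛ι₂ cx av) others₂) others₁
    perm : (r + l + 1) ∷ ps₁ ++ ps₂ ↭ map proj₂ (glued ∷ reps)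
    perm = prep (r + l + 1) (↭-trans (↭ₚ.++⁺ perm₁ perm₂) (↭-reflexive (sym (begin
      map proj₂ (reps₁ ++ reps₂)             ≡⟨ Listₚ.map-++ proj₂ reps₁ reps₂ ⟩
      map proj₂ reps₁ ++ map proj₂ reps₂     ≡⟨ cong₂ _++_ (Listₚ.map-∘ rest₁) (Listₚ.map-∘ rest₂) ⟨
      map proj₂ rest₁ ++ map proj₂ rest₂     ∎))))
      where open ≡-Reasoning

  OnHingeOrbits : X → Set
  OnHingeOrbits z = (Σ X₁ λ x → O₁.Reaches S₁ x × z ≡ ι₁ x) ⊎ (Σ X₂ λ y → O₂.Reaches S₂ y × z ≡ ι₂ y)
                  ⊎ z ≡ e₁ ⊎ z ≡ e₂

  onHingeOrbits-closed : ∀ z → OnHingeOrbits z → OnHingeOrbits (f z)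
  onHingeOrbits-closed _ (inj₁ (_ , (k , refl) , refl)) with f₁ (iter f₁ k S₁) ≟₁ S₁
  ... | yes hit = inj₂ (inj₂ (inj₁ (hit₁ _ (Side₁.C₁-iter k S₁ C₁S₁) hit)))
  ... | no miss = inj₁ (_ , (suc k , refl) , step₁ _ (Side₁.C₁-iter k S₁ C₁S₁) miss)
  onHingeOrbits-closed _ (inj₂ (inj₁ (_ , (k , refl) , refl))) with f₂ (iter f₂ k S₂) ≟₂ S₂
  ... | yes hit = inj₂ (inj₂ (inj₂ (hit₂ _ (Side₂.C₁-iter k S₂ C₂S₂) hit)))
  ... | no miss = inj₂ (inj₁ (_ , (suc k , refl) , step₂ _ (Side₂.C₁-iter k S₂ C₂S₂) miss))
  onHingeOrbits-closed _ (inj₂ (inj₂ (inj₁ refl))) = inj₂ (inj₁ (S₂ , (0 , refl) , bridge₁))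
  onHingeOrbits-closed _ (inj₂ (inj₂ (inj₂ refl))) = inj₁ (S₁ , (0 , refl) , bridge₂)

  returnsTo₁ : ∀ {x} → C₁ x → Reaches (ι₂ S₂) (ι₁ x) → O₁.Reaches S₁ x
  returnsTo₁ {x} cx (k , e)
    with subst OnHingeOrbits e (O.iter-invariant OnHingeOrbits onHingeOrbits-closed k (ι₂ S₂)
                                 (inj₂ (inj₁ (S₂ , (0 , refl) , refl))))
  ... | inj₁ (x′ , r , e′) = subst (O₁.Reaches S₁) (sym (ι₁-inj e′)) r
  ... | inj₂ (inj₁ (y , _ , e′)) = ⊥-elim (ι₁≢ι₂ x y e′)
  ... | inj₂ (inj₂ (inj₁ e′)) = ⊥-elim (e₁≢ι₁ x cx (sym e′))
  ... | inj₂ (inj₂ (inj₂ e′)) = ⊥-elim (e₂≢ι₁ x (sym e′))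

  crossingCycle : ∀ {x y p} → C₁ x → CycleLength (ι₁ x) p → Reaches (ι₁ x) (ι₂ y) →
                  O₁.Reaches x S₁ × O₁.Reaches S₁ x
  crossingCycle cx cl (k , e) with Side₁.mustHit {q = k} cx e
  ... | h , fh@(_ , hit) =
        (suc h , hit) , returnsTo₁ cx (O.reaches-sym cl (suc (suc h) , Side₁.crossOver 0 cx fh))

  AvoidingCopy : X → Set
  AvoidingCopy z = Σ X₁ λ x → C₁ x × z ≡ ι₁ x × Side₁.Avoids₁ x

  classify : ∀ {z c} → Rep (z , c) →
             AvoidingCopy z ⊎ (∀ x → C₁ x → Side₁.Avoids₁ x → ¬ Reaches z (ι₁ x))
  classify {z} {c} (cz , clz) with C-cases z cz
  ... | inj₁ (x , cx , refl) with Side₁.missesOrHits x (2 * c)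
  ...   | inj₁ misses = inj₁ (x , cx , refl , Side₁.missesForever cx clz misses)
  ...   | inj₂ (h , _ , _ , hit) = inj₂ λ x′ cx′ av′ r →
          uncurry av′ (O₁.reaches-trans (Side₁.reaches-restrict cx′ av′ (O.reaches-sym clz r)) (suc h , hit))
  classify (cz , clz) | inj₂ (inj₁ (y , cy , refl)) =
    inj₂ λ x cx av r → Side₁.avoiding↛ι₂ cx av (O.reaches-sym clz r)
  classify (cz , clz) | inj₂ (inj₂ (inj₁ refl)) =
    inj₂ λ x cx av r → let (x′ , cx′ , e) = Side₁.avoiding-stays cx av (O.reaches-sym clz r)
                       in e₁≢ι₁ x′ cx′ e
  classify (cz , clz) | inj₂ (inj₂ (inj₂ refl)) =
    inj₂ λ x cx av r → let (x′ , cx′ , e) = Side₁.avoiding-stays cx av (O.reaches-sym clz r)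
                       in e₂≢ι₁ x′ e

  CopiedFrom : List (X × ℕ) → X₁ × ℕ → Set
  CopiedFrom rs ρ = Any (λ r → proj₁ r ≡ ι₁ (proj₁ ρ)) rs

  restrictReps : (rs : List (X × ℕ)) → All Rep rs → AllPairs Distinct rs →
    Σ (List (X₁ × ℕ)) λ rs₁ → All Side₁.OtherCycle₁ rs₁
      × AllPairs (λ ρ ρ′ → ¬ O₁.Reaches (proj₁ ρ) (proj₁ ρ′)) rs₁
      × (∀ x → C₁ x → Side₁.Avoids₁ x → Any (λ r → Reaches (proj₁ r) (ι₁ x)) rs →
           Any (λ ρ → O₁.Reaches (proj₁ ρ) x) rs₁)
      × All (CopiedFrom rs) rs₁
  restrictReps [] [] [] = [] , [] , [] , (λ _ _ _ ()) , []
  restrictReps ((z , c) ∷ rs) (ok ∷ oks) (d ∷ ds) with restrictReps rs oks ds | classify {z} {c} ok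
  ... | rs₁ , others , distinct , covers , origins | inj₂ noCopy =
        rs₁ , others , distinct , covers′ , All.map there origins
    where
    covers′ : ∀ x → C₁ x → Side₁.Avoids₁ x → Any (λ r → Reaches (proj₁ r) (ι₁ x)) ((z , c) ∷ rs) →
              Any (λ ρ → O₁.Reaches (proj₁ ρ) x) rs₁
    covers′ x cx av (here r) = ⊥-elim (noCopy x cx av r)
    covers′ x cx av (there a) = covers x cx av a
  ... | rs₁ , others , distinct , covers , origins | inj₁ (x , cx , refl , av) =
        (x , c) ∷ rs₁ , ((cx , Side₁.cycleLength-restrict cx av (proj₂ ok)) , av) ∷ others ,
        All.map (λ {ρ} → headDistinct {ρ}) origins ∷ distinct , covers′ , here refl ∷ All.map there origins
    where
    headDistinct : ∀ {ρ} → CopiedFrom rs ρ → ¬ O₁.Reaches x (proj₁ ρ)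
    headDistinct o r with All.lookupAny d o
    ... | nd , e = nd (subst (Reaches (ι₁ x)) (sym e) (Side₁.reaches-embed cx av r))
    covers′ : ∀ x′ → C₁ x′ → Side₁.Avoids₁ x′ → Any (λ r → Reaches (proj₁ r) (ι₁ x′)) ((ι₁ x , c) ∷ rs) →
              Any (λ ρ → O₁.Reaches (proj₁ ρ) x′) ((x , c) ∷ rs₁)
    covers′ x′ cx′ av′ (here r) = here (Side₁.reaches-restrict cx av r)
    covers′ x′ cx′ av′ (there a) = there (covers x′ cx′ av′ a)

  sideProfile : ∀ {ps T m} → ProfileOf C ps → C₁ T → O₁.CycleLength T (2 * m) → O₁.Reaches T S₁ →
                Σ (List ℕ) λ ps₁ → O₁.ProfileOf C₁ (m ∷ ps₁)
  sideProfile {ps} {T} {m} (reps , reps-ok , covers , distinct , _) cT clT T→S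
    with restrictReps reps reps-ok distinct
  ... | rs₁ , others , distinct₁ , covers₁ , _ =
        map proj₂ rs₁ , (T , m) ∷ rs₁ ,
        (cT , clT) ∷ All.map proj₁ others ,
        covers′ , All.map (λ {ρ} → headDistinct {ρ}) others ∷ distinct₁ , ↭-refl
    where
    headDistinct : ∀ {ρ} → Side₁.OtherCycle₁ ρ → ¬ O₁.Reaches T (proj₁ ρ)
    headDistinct (_ , av) r = uncurry av (O₁.reaches-trans (O₁.reaches-sym clT r) T→S)
    -- a point z of side 1 either avoids S₁, and then its cycle is restricted
    -- from f, or it meets S₁, and then its copy lies on a cycle through the
    -- bridge e₁, which returns to z through S₁
    covers′ : ∀ z → C₁ z → Any (λ ρ → O₁.Reaches (proj₁ ρ) z) ((T , m) ∷ rs₁)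
    covers′ z cz with find (covers (ι₁ z) (C-ι₁ z cz))
    ... | (_ , c) , ρ∈reps , ρ→z with O.cycleLength-along (proj₂ (All.lookup reps-ok ρ∈reps)) ρ→z
    ...   | clz with Side₁.missesOrHits z (2 * c)
    ...     | inj₁ misses =
              there (covers₁ z cz (Side₁.missesForever cz clz misses) (covers (ι₁ z) (C-ι₁ z cz)))
    ...     | inj₂ (h , _ , fh) = here (O₁.reaches-trans T→S
              (returnsTo₁ cz (O.reaches-sym clz (suc (suc h) , Side₁.crossOver 0 cz fh))))

  crossingPath : ∀ {T₁ h} d → C₁ T₁ → Side₁.FirstHitAt T₁ h → Side₂.MissesFor S₂ d →
                 iter f (d + suc (suc h)) (ι₁ T₁) ≡ ι₂ (iter f₂ d S₂)
  crossingPath d cT fh misses = trans (Side₁.crossOver d cT fh) (Side₂.walk d C₂S₂ misses)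

  crossingPath-first : ∀ {T₁ h d T₂} → C₁ T₁ → Side₁.FirstHitAt T₁ h → Side₂.MissesFor S₂ d →
    (∀ i → i < d → iter f₂ i S₂ ≢ T₂) → ∀ j → j < d + suc (suc h) → iter f j (ι₁ T₁) ≢ ι₂ T₂
  crossingPath-first {T₁} {h} {d} {T₂} cT fh@(missesS₁ , _) missesS₂ notYet j j< eq
    with belowOrAbove (suc h) j
  ... | inj₁ j<h+1 = ι₁≢ι₂ _ _ (trans (sym (Side₁.walk j cT
                       (λ i i<j → missesS₁ i (ℕP.<-≤-trans i<j (ℕP.≤-pred j<h+1))))) eq)
  ... | inj₂ (zero , refl) = e₁≢ι₂ _ (trans (sym (Side₁.reachBridge cT fh)) eq)
  ... | inj₂ (suc i , refl) = notYet i i<d (ι₂-inj (begin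
        ι₂ (iter f₂ i S₂)                ≡⟨ crossingPath i cT fh (λ i′ i′<i → missesS₂ i′ (ℕP.<-trans i′<i i<d)) ⟨
        iter f (i + suc (suc h)) (ι₁ T₁) ≡⟨ cong (λ k → iter f k (ι₁ T₁)) (ℕP.+-suc i (suc h)) ⟩
        iter f (suc i + suc h) (ι₁ T₁)   ≡⟨ eq ⟩
        ι₂ T₂                            ∎))
    where
    open ≡-Reasoning
    i<d : i < d
    i<d = ℕP.+-cancelʳ-< (suc (suc h)) i d (subst (_< d + suc (suc h)) (sym (ℕP.+-suc i (suc h))) j<)

module Diagram {A : Set} {n : ℕ} (π : LabPerm A n) where

  tpos bpos : A → ℕ
  tpos a = toℕ (πt π a)
  bpos a = toℕ (πb π a)

  tpos-inj : ∀ {a c} → tpos a ≡ tpos c → a ≡ c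
  tpos-inj e = Injection.injective (↔⇒↣ (top π)) (FinP.toℕ-injective e)
  bpos-inj : ∀ {a c} → bpos a ≡ bpos c → a ≡ c
  bpos-inj e = Injection.injective (↔⇒↣ (bot π)) (FinP.toℕ-injective e)

  tpos-πt⁻¹ : ∀ i → tpos (πt⁻¹ π i) ≡ toℕ i
  tpos-πt⁻¹ i = cong toℕ (Inverse.strictlyInverseˡ (top π) i)
  bpos-πb⁻¹ : ∀ i → bpos (πb⁻¹ π i) ≡ toℕ i
  bpos-πb⁻¹ i = cong toℕ (Inverse.strictlyInverseˡ (bot π) i)

  tpos≤ : ∀ a → tpos a ≤ n
  tpos≤ a = ℕP.≤-pred (FinP.toℕ<n (πt π a))
  bpos≤ : ∀ a → bpos a ≤ n
  bpos≤ a = ℕP.≤-pred (FinP.toℕ<n (πb π a))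

  firstTop firstBot lastTop lastBot : A
  firstTop = πt⁻¹ π zero
  firstBot = πb⁻¹ π zero
  lastTop = πt⁻¹ π (fromℕ n)
  lastBot = πb⁻¹ π (fromℕ n)

  tpos-lastTop : tpos lastTop ≡ n
  tpos-lastTop = trans (tpos-πt⁻¹ _) (FinP.toℕ-fromℕ n)
  bpos-lastBot : bpos lastBot ≡ n
  bpos-lastBot = trans (bpos-πb⁻¹ _) (FinP.toℕ-fromℕ n)

  σ̃-outFirst : ∀ a → bpos a ≡ 0 → σ̃ π (out a) ≡ out firstTop
  σ̃-outFirst a e with πb π a
  ... | zero = refl
  ... | suc j = ⊥-elim (ℕP.1+n≢0 e)

  σ̃-outLater : ∀ a j → bpos a ≡ suc j → Σ A λ c → σ̃ π (out a) ≡ inn c × bpos c ≡ j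
  σ̃-outLater a j e with πb π a
  ... | zero = ⊥-elim (ℕP.1+n≢0 (sym e))
  ... | suc i = πb⁻¹ π (inject₁ i) , refl ,
        trans (bpos-πb⁻¹ _) (trans (FinP.toℕ-inject₁ i) (ℕP.suc-injective e))

  σ̃-innLast : ∀ a → tpos a ≡ n → σ̃ π (inn a) ≡ inn lastBot
  σ̃-innLast a e with n ℕ.≟ toℕ (πt π a)
  ... | yes _ = refl
  ... | no ne = ⊥-elim (ne (sym e))

  σ̃-innEarlier : ∀ a → tpos a ≢ n → Σ A λ c → σ̃ π (inn a) ≡ out c × tpos c ≡ suc (tpos a)
  σ̃-innEarlier a ne with n ℕ.≟ toℕ (πt π a)
  ... | yes e = ⊥-elim (ne (sym e))
  ... | no ne' = _ , refl , trans (tpos-πt⁻¹ _) (cong suc (FinP.toℕ-lower₁ _ ne'))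

  canon-outFirst : ∀ a → bpos a ≡ 0 → canon π (out a) ≡ out firstTop
  canon-outFirst a e with πb π a
  ... | zero = refl
  ... | suc j = ⊥-elim (ℕP.1+n≢0 e)

  canon-outLater : ∀ a → bpos a ≢ 0 → canon π (out a) ≡ out a
  canon-outLater a ne with πb π a
  ... | zero = ⊥-elim (ne refl)
  ... | suc j = refl

  canon-innLast : ∀ a → tpos a ≡ n → canon π (inn a) ≡ inn lastBot
  canon-innLast a e with n ℕ.≟ toℕ (πt π a)
  ... | yes _ = refl
  ... | no ne = ⊥-elim (ne (sym e))

  canon-innEarlier : ∀ a → tpos a ≢ n → canon π (inn a) ≡ inn a
  canon-innEarlier a ne with n ℕ.≟ toℕ (πt π a)
  ... | yes e = ⊥-elim (ne (sym e))
  ... | no _ = refl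

  L-canonical : canon π (out firstTop) ≡ out firstTop
  L-canonical with bpos firstTop ℕ.≟ 0
  ... | yes e = canon-outFirst firstTop e
  ... | no ne = canon-outLater firstTop ne

  R-canonical : canon π (inn lastBot) ≡ inn lastBot
  R-canonical with tpos lastBot ℕ.≟ n
  ... | yes e = canon-innLast lastBot e
  ... | no ne = canon-innEarlier lastBot ne

  canon-idempotent : ∀ y → canon π (canon π y) ≡ canon π y
  canon-idempotent (out a) with bpos a ℕ.≟ 0
  ... | yes e = trans (cong (canon π) (canon-outFirst a e)) (trans L-canonical (sym (canon-outFirst a e)))
  ... | no ne = cong (canon π) (canon-outLater a ne)
  canon-idempotent (inn a) with tpos a ℕ.≟ n
  ... | yes e = trans (cong (canon π) (canon-innLast a e)) (trans R-canonical (sym (canon-innLast a e)))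
  ... | no ne = cong (canon π) (canon-innEarlier a ne)

  σ-canonical : ∀ x → Canonical π (σ π x)
  σ-canonical x = canon-idempotent (σ̃ π x)

  kind : Sym A → Bool
  kind (out _) = false
  kind (inn _) = true

  kind-canon-out : ∀ a → kind (canon π (out a)) ≡ false
  kind-canon-out a with bpos a ℕ.≟ 0
  ... | yes e = cong kind (canon-outFirst a e)
  ... | no ne = cong kind (canon-outLater a ne)
  kind-canon-inn : ∀ a → kind (canon π (inn a)) ≡ true
  kind-canon-inn a with tpos a ℕ.≟ n
  ... | yes e = cong kind (canon-innLast a e)
  ... | no ne = cong kind (canon-innEarlier a ne)

  L-fixed : firstTop ≡ firstBot → σ π (out firstTop) ≡ out firstTop
  L-fixed e = trans (cong (canon π) (σ̃-outFirst firstTop (trans (cong bpos e) (bpos-πb⁻¹ zero)))) L-canonical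
  R-fixed : lastTop ≡ lastBot → σ π (inn lastBot) ≡ inn lastBot
  R-fixed e = trans (cong (canon π) (σ̃-innLast lastBot (trans (cong tpos (sym e)) tpos-lastTop))) R-canonical

  out-inj : ∀ {a c : A} → out a ≡ out c → a ≡ c
  out-inj refl = refl
  inn-inj : ∀ {a c : A} → inn a ≡ inn c → a ≡ c
  inn-inj refl = refl

  out≢inn : ∀ {a c : A} → out a ≢ inn c
  out≢inn ()

  σ-alternates : σ π (out firstTop) ≢ out firstTop → σ π (inn lastBot) ≢ inn lastBot →
                 ∀ x → Canonical π x → kind (σ π x) ≡ not (kind x)
  σ-alternates notFixedL _ (out a) cx with bpos a ℕ.≟ 0
  ... | yes first = ⊥-elim (notFixedL (subst (λ z → σ π (out z) ≡ out z) a≡firstTop fixed))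
    where
    a≡firstTop : a ≡ firstTop
    a≡firstTop = out-inj (trans (sym cx) (canon-outFirst a first))
    fixed : σ π (out a) ≡ out a
    fixed = trans (cong (canon π) (σ̃-outFirst a first)) (trans L-canonical (cong out (sym a≡firstTop)))
  ... | no later with bpos a in eb
  ...   | zero = ⊥-elim (later refl)
  ...   | suc j with σ̃-outLater a j eb
  ...     | c , e , _ = trans (cong (λ z → kind (canon π z)) e) (kind-canon-inn c)
  σ-alternates _ notFixedR (inn a) cx with tpos a ℕ.≟ n
  ... | yes last = ⊥-elim (notFixedR (R-fixed (tpos-inj (trans tpos-lastTop (trans (sym last) (cong tpos a≡lastBot))))))
    where
    a≡lastBot : a ≡ lastBot
    a≡lastBot = inn-inj (trans (sym cx) (canon-innLast a last))
  ... | no earlier with σ̃-innEarlier a earlier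
  ...   | c , e , _ = trans (cong (λ z → kind (canon π z)) e) (kind-canon-out c)

  _≟A_ : DecidableEquality A
  a ≟A c with tpos a ℕ.≟ tpos c
  ... | yes e = yes (tpos-inj e)
  ... | no ne = no (λ eq → ne (cong tpos eq))

  _≟Sym_ : DecidableEquality (Sym A)
  out a ≟Sym out c with a ≟A c
  ... | yes e = yes (cong out e)
  ... | no ne = no (λ eq → ne (out-inj eq))
  out a ≟Sym inn c = no out≢inn
  inn a ≟Sym out c = no (λ eq → out≢inn (sym eq))
  inn a ≟Sym inn c with a ≟A c
  ... | yes e = yes (cong inn e)
  ... | no ne = no (λ eq → ne (inn-inj eq))

  σ̃-into-lastBot : ∀ x → σ̃ π x ≡ inn lastBot → x ≡ inn lastTop
  σ̃-into-lastBot (out a) e with bpos a in eb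
  ... | zero = ⊥-elim (out≢inn (trans (sym (σ̃-outFirst a eb)) e))
  ... | suc j with σ̃-outLater a j eb
  ...   | c , e′ , bpos-c = ⊥-elim (ℕP.<-irrefl refl n<n)
    where
    n<n : n < n
    n<n = begin-strict
      n        ≡⟨ bpos-lastBot ⟨
      bpos lastBot ≡⟨ cong bpos (inn-inj (trans (sym e) e′)) ⟩
      bpos c   ≡⟨ bpos-c ⟩
      j        <⟨ ℕP.n<1+n j ⟩
      suc j    ≡⟨ eb ⟨
      bpos a   ≤⟨ bpos≤ a ⟩
      n        ∎
      where open ℕP.≤-Reasoning
  σ̃-into-lastBot (inn a) e with tpos a ℕ.≟ n
  ... | yes last = cong inn (tpos-inj (trans last (sym tpos-lastTop)))
  ... | no earlier with σ̃-innEarlier a earlier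
  ...   | c , e′ , _ = ⊥-elim (out≢inn (trans (sym e′) e))

  σ̃-into-firstTop : ∀ x → σ̃ π x ≡ out firstTop → x ≡ out firstBot
  σ̃-into-firstTop (out a) e with bpos a in eb
  ... | zero = cong out (bpos-inj (trans eb (sym (bpos-πb⁻¹ zero))))
  ... | suc j with σ̃-outLater a j eb
  ...   | c , e′ , _ = ⊥-elim (out≢inn (trans (sym e) e′))
  σ̃-into-firstTop (inn a) e with tpos a ℕ.≟ n
  ... | yes last = ⊥-elim (out≢inn (trans (sym e) (σ̃-innLast a last)))
  ... | no earlier with σ̃-innEarlier a earlier
  ...   | c , e′ , tpos-c = ⊥-elim (ℕP.1+n≢0 (begin
      suc (tpos a) ≡⟨ tpos-c ⟨
      tpos c       ≡⟨ cong tpos (out-inj (trans (sym e′) e)) ⟩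
      tpos firstTop ≡⟨ tpos-πt⁻¹ zero ⟩
      0            ∎))
    where open ≡-Reasoning

  lastTop-canonical : Canonical π (inn lastTop) → lastTop ≡ lastBot
  lastTop-canonical c = sym (inn-inj (trans (sym (canon-innLast lastTop tpos-lastTop)) c))

  firstBot-canonical : Canonical π (out firstBot) → firstTop ≡ firstBot
  firstBot-canonical c = out-inj (trans (sym (canon-outFirst firstBot (bpos-πb⁻¹ zero))) c)

  canon≡R : ∀ w → canon π w ≡ inn lastBot → w ≡ inn lastTop ⊎ w ≡ inn lastBot
  canon≡R (out a) e = ⊥-elim (false≢true (trans (sym (kind-canon-out a)) (cong kind e)))
    where
    false≢true : false ≢ true
    false≢true ()
  canon≡R (inn a) e with tpos a ℕ.≟ n
  ... | yes last = inj₁ (cong inn (tpos-inj (trans last (sym tpos-lastTop))))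
  ... | no earlier = inj₂ (trans (sym (canon-innEarlier a earlier)) e)

  canon≡L : ∀ w → canon π w ≡ out firstTop → w ≡ out firstBot ⊎ w ≡ out firstTop
  canon≡L (inn a) e = ⊥-elim (true≢false (trans (sym (kind-canon-inn a)) (cong kind e)))
    where
    true≢false : true ≢ false
    true≢false ()
  canon≡L (out a) e with bpos a ℕ.≟ 0
  ... | yes first = inj₁ (cong out (bpos-inj (trans first (sym (bpos-πb⁻¹ zero)))))
  ... | no later = inj₂ (trans (sym (canon-outLater a later)) e)

ι₁ : ∀ {A B : Set} → Sym A → Sym (A ⊎ B)
ι₁ (out a) = out (inj₁ a)
ι₁ (inn a) = inn (inj₁ a)

ι₂ : ∀ {A B : Set} → Sym B → Sym (A ⊎ B)
ι₂ (out b) = out (inj₂ b)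
ι₂ (inn b) = inn (inj₂ b)

ι₁-inj : ∀ {A B : Set} {x y : Sym A} → ι₁ {B = B} x ≡ ι₁ y → x ≡ y
ι₁-inj {x = out a} {out .a} refl = refl
ι₁-inj {x = inn a} {inn .a} refl = refl

ι₂-inj : ∀ {A B : Set} {x y : Sym B} → ι₂ {A = A} x ≡ ι₂ y → x ≡ y
ι₂-inj {x = out b} {out .b} refl = refl
ι₂-inj {x = inn b} {inn .b} refl = refl

ι₁≢ι₂ : ∀ {A B : Set} (x : Sym A) (y : Sym B) → ι₁ x ≢ ι₂ y
ι₁≢ι₂ (out a) (out b) ()
ι₁≢ι₂ (out a) (inn b) ()
ι₁≢ι₂ (inn a) (out b) ()
ι₁≢ι₂ (inn a) (inn b) ()

module Concatenation {A B : Set} {k₁ k₂ : ℕ} (π₁ : LabPerm A k₁) (π₂ : LabPerm B k₂) where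
  π : LabPerm (A ⊎ B) (k₁ + suc k₂)
  π = π₁ · π₂
  module D₁ = Diagram π₁
  module D₂ = Diagram π₂
  module D = Diagram π

  N : ℕ
  N = k₁ + suc k₂

  1+k₁+k₂≡N : suc k₁ + k₂ ≡ N
  1+k₁+k₂≡N = sym (ℕP.+-suc k₁ k₂)

  tpos₁ : ∀ a → D.tpos (inj₁ a) ≡ D₁.tpos a
  tpos₁ a = FinP.toℕ-↑ˡ (πt π₁ a) (suc k₂)
  bpos₁ : ∀ a → D.bpos (inj₁ a) ≡ D₁.bpos a
  bpos₁ a = FinP.toℕ-↑ˡ (πb π₁ a) (suc k₂)
  tpos₂ : ∀ b → D.tpos (inj₂ b) ≡ suc k₁ + D₂.tpos b
  tpos₂ b = FinP.toℕ-↑ʳ (suc k₁) (πt π₂ b)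
  bpos₂ : ∀ b → D.bpos (inj₂ b) ≡ suc k₁ + D₂.bpos b
  bpos₂ b = FinP.toℕ-↑ʳ (suc k₁) (πb π₂ b)

  tpos₁≢N : ∀ a → D.tpos (inj₁ a) ≢ N
  tpos₁≢N a e = ℕP.<⇒≢ (ℕP.≤-<-trans (D₁.tpos≤ a) (ℕP.m<m+n k₁ z<s)) (trans (sym (tpos₁ a)) e)

  bpos₂≢0 : ∀ b → D.bpos (inj₂ b) ≢ 0
  bpos₂≢0 b e = ℕP.1+n≢0 (trans (sym (bpos₂ b)) e)

  tpos₂≢N : ∀ b → D₂.tpos b ≢ k₂ → D.tpos (inj₂ b) ≢ N
  tpos₂≢N b ne e = ne (ℕP.+-cancelˡ-≡ (suc k₁) _ _ (trans (sym (tpos₂ b)) (trans e (sym 1+k₁+k₂≡N))))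

  tpos₁≢k₁ : ∀ {a} → a ≢ D₁.lastTop → D₁.tpos a ≢ k₁
  tpos₁≢k₁ ne e = ne (D₁.tpos-inj (trans e (sym D₁.tpos-lastTop)))

  bpos₂≢0′ : ∀ {b} → b ≢ D₂.firstBot → D₂.bpos b ≢ 0
  bpos₂≢0′ ne e = ne (D₂.bpos-inj (trans e (sym (D₂.bpos-πb⁻¹ zero))))

  lastBot≡ : D.lastBot ≡ inj₂ D₂.lastBot
  lastBot≡ = D.bpos-inj (begin
    D.bpos D.lastBot             ≡⟨ D.bpos-lastBot ⟩
    N                            ≡⟨ 1+k₁+k₂≡N ⟨
    suc k₁ + k₂                  ≡⟨ cong (suc k₁ +_) D₂.bpos-lastBot ⟨
    suc k₁ + D₂.bpos D₂.lastBot  ≡⟨ bpos₂ D₂.lastBot ⟨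
    D.bpos (inj₂ D₂.lastBot)     ∎)
    where open ≡-Reasoning

  -- R of π is R of π₂ (and L of π is L of π₁, by computation)
  R≡ : Rsym π ≡ ι₂ (Rsym π₂)
  R≡ = cong inn lastBot≡

  σ̃-ι₁ : ∀ y → y ≢ inn D₁.lastTop → σ̃ π (ι₁ y) ≡ ι₁ (σ̃ π₁ y)
  σ̃-ι₁ (out a) _ with D₁.bpos a in e
  ... | zero = trans (D.σ̃-outFirst (inj₁ a) (trans (bpos₁ a) e)) (cong ι₁ (sym (D₁.σ̃-outFirst a e)))
  ... | suc j with D.σ̃-outLater (inj₁ a) j (trans (bpos₁ a) e) | D₁.σ̃-outLater a j e
  ...   | c , e₀ , bpos-c | c₁ , e₀′ , bpos-c₁ =
          trans e₀ (trans (cong inn (D.bpos-inj (trans bpos-c (trans (sym bpos-c₁) (sym (bpos₁ c₁))))))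
                          (cong ι₁ (sym e₀′)))
  σ̃-ι₁ (inn a) ne with D.σ̃-innEarlier (inj₁ a) (tpos₁≢N a) | D₁.σ̃-innEarlier a (tpos₁≢k₁ (λ e → ne (cong inn e)))
  ... | c , e₀ , tpos-c | c₁ , e₀′ , tpos-c₁ =
          trans e₀ (trans (cong out (D.tpos-inj (trans tpos-c (trans (cong suc (tpos₁ a))
                                                  (trans (sym tpos-c₁) (sym (tpos₁ c₁)))))))
                          (cong ι₁ (sym e₀′)))

  canon-ι₁ : ∀ y → y ≢ inn D₁.lastTop → canon π (ι₁ y) ≡ ι₁ (canon π₁ y)
  canon-ι₁ (out a) _ with D₁.bpos a ℕ.≟ 0
  ... | yes first = trans (D.canon-outFirst (inj₁ a) (trans (bpos₁ a) first))
                          (cong ι₁ (sym (D₁.canon-outFirst a first)))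
  ... | no later = trans (D.canon-outLater (inj₁ a) (λ e → later (trans (sym (bpos₁ a)) e)))
                         (cong ι₁ (sym (D₁.canon-outLater a later)))
  canon-ι₁ (inn a) ne = trans (D.canon-innEarlier (inj₁ a) (tpos₁≢N a))
                              (cong ι₁ (sym (D₁.canon-innEarlier a (tpos₁≢k₁ (λ e → ne (cong inn e))))))

  σ̃-ι₂ : ∀ y → y ≢ out D₂.firstBot → σ̃ π (ι₂ y) ≡ ι₂ (σ̃ π₂ y)
  σ̃-ι₂ (out b) ne with D₂.bpos b in e
  ... | zero = ⊥-elim (bpos₂≢0′ (λ q → ne (cong out q)) e)
  ... | suc j with D.σ̃-outLater (inj₂ b) (k₁ + suc j) (trans (bpos₂ b) (cong (suc k₁ +_) e))
                 | D₂.σ̃-outLater b j e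
  ...   | c , e₀ , bpos-c | c₂ , e₀′ , bpos-c₂ =
          trans e₀ (trans (cong inn (D.bpos-inj (trans bpos-c (trans (ℕP.+-suc k₁ j)
                                                  (trans (cong (suc k₁ +_) (sym bpos-c₂)) (sym (bpos₂ c₂)))))))
                          (cong ι₂ (sym e₀′)))
  σ̃-ι₂ (inn b) _ with D₂.tpos b ℕ.≟ k₂
  ... | yes last = trans (D.σ̃-innLast (inj₂ b) (trans (tpos₂ b) (trans (cong (suc k₁ +_) last) 1+k₁+k₂≡N)))
                         (trans (cong inn lastBot≡) (cong ι₂ (sym (D₂.σ̃-innLast b last))))
  ... | no notLast with D.σ̃-innEarlier (inj₂ b) (tpos₂≢N b notLast) | D₂.σ̃-innEarlier b notLast
  ...   | c , e₀ , tpos-c | c₂ , e₀′ , tpos-c₂ =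
          trans e₀ (trans (cong out (D.tpos-inj (trans tpos-c (trans (cong suc (tpos₂ b))
                     (trans (sym (ℕP.+-suc (suc k₁) _)) (trans (cong (suc k₁ +_) (sym tpos-c₂)) (sym (tpos₂ c₂))))))))
                          (cong ι₂ (sym e₀′)))

  canon-ι₂ : ∀ y → y ≢ out D₂.firstBot → canon π (ι₂ y) ≡ ι₂ (canon π₂ y)
  canon-ι₂ (out b) ne = trans (D.canon-outLater (inj₂ b) (bpos₂≢0 b))
                              (cong ι₂ (sym (D₂.canon-outLater b (bpos₂≢0′ (λ q → ne (cong out q))))))
  canon-ι₂ (inn b) _ with D₂.tpos b ℕ.≟ k₂
  ... | yes last = trans (D.canon-innLast (inj₂ b) (trans (tpos₂ b) (trans (cong (suc k₁ +_) last) 1+k₁+k₂≡N)))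
                         (trans (cong inn lastBot≡) (cong ι₂ (sym (D₂.canon-innLast b last))))
  ... | no notLast = trans (D.canon-innEarlier (inj₂ b) (tpos₂≢N b notLast))
                           (cong ι₂ (sym (D₂.canon-innEarlier b notLast)))

  -- the hinges, and the bridges: the two symbols that were identified with
  -- R₁ and L₂ and are distinct symbols of π
  R₁ : Sym A
  R₁ = Rsym π₁
  L₂ : Sym B
  L₂ = Lsym π₂
  e₁ e₂ : Sym (A ⊎ B)
  e₁ = ι₁ (inn D₁.lastTop)
  e₂ = ι₂ (out D₂.firstBot)

  bridge₁ : σ π e₁ ≡ ι₂ L₂
  bridge₁ with D.σ̃-innEarlier (inj₁ D₁.lastTop) (tpos₁≢N D₁.lastTop)
  ... | c , e₀ , tpos-c = trans (cong (canon π) e₀)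
          (trans (cong (λ z → canon π (out z)) c≡) (D.canon-outLater (inj₂ D₂.firstTop) (bpos₂≢0 _)))
    where
    c≡ : c ≡ inj₂ D₂.firstTop
    c≡ = D.tpos-inj (begin
      D.tpos c                          ≡⟨ tpos-c ⟩
      suc (D.tpos (inj₁ D₁.lastTop))    ≡⟨ cong suc (trans (tpos₁ D₁.lastTop) D₁.tpos-lastTop) ⟩
      suc k₁                            ≡⟨ cong suc (ℕP.+-identityʳ k₁) ⟨
      suc k₁ + 0                        ≡⟨ cong (suc k₁ +_) (D₂.tpos-πt⁻¹ zero) ⟨
      suc k₁ + D₂.tpos D₂.firstTop      ≡⟨ tpos₂ D₂.firstTop ⟨
      D.tpos (inj₂ D₂.firstTop)         ∎)
      where open ≡-Reasoning

  bridge₂ : σ π e₂ ≡ ι₁ R₁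
  bridge₂ with D.σ̃-outLater (inj₂ D₂.firstBot) (k₁ + 0)
                 (trans (bpos₂ D₂.firstBot) (cong (suc k₁ +_) (D₂.bpos-πb⁻¹ zero)))
  ... | c , e₀ , bpos-c = trans (cong (canon π) e₀)
          (trans (cong (λ z → canon π (inn z)) c≡) (D.canon-innEarlier (inj₁ D₁.lastBot) (tpos₁≢N _)))
    where
    c≡ : c ≡ inj₁ D₁.lastBot
    c≡ = D.bpos-inj (trans bpos-c (trans (ℕP.+-identityʳ k₁) (sym (trans (bpos₁ D₁.lastBot) D₁.bpos-lastBot))))

  R₁-fixed : D₁.lastTop ≡ D₁.lastBot → σ π₁ (inn D₁.lastTop) ≡ R₁
  R₁-fixed e = subst (λ z → σ π₁ (inn z) ≡ R₁) (sym e) (D₁.R-fixed e)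
  L₂-fixed : D₂.firstTop ≡ D₂.firstBot → σ π₂ (out D₂.firstBot) ≡ L₂
  L₂-fixed e = subst (λ z → σ π₂ (out z) ≡ L₂) e (D₂.L-fixed e)

  notLastTop₁ : ∀ x → Canonical π₁ x → σ π₁ x ≢ R₁ → x ≢ inn D₁.lastTop
  notLastTop₁ x cx ne refl = ne (R₁-fixed (D₁.lastTop-canonical cx))
  notLastTop₁′ : D₁.lastTop ≢ D₁.lastBot → ∀ x → Canonical π₁ x → x ≢ inn D₁.lastTop
  notLastTop₁′ R₁-moves x cx refl = R₁-moves (D₁.lastTop-canonical cx)
  notFirstBot₂ : ∀ y → Canonical π₂ y → σ π₂ y ≢ L₂ → y ≢ out D₂.firstBot
  notFirstBot₂ y cy ne refl = ne (L₂-fixed (D₂.firstBot-canonical cy))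
  notFirstBot₂′ : D₂.firstTop ≢ D₂.firstBot → ∀ y → Canonical π₂ y → y ≢ out D₂.firstBot
  notFirstBot₂′ L₂-moves y cy refl = L₂-moves (D₂.firstBot-canonical cy)

  step₁ : ∀ x → Canonical π₁ x → σ π₁ x ≢ R₁ → σ π (ι₁ x) ≡ ι₁ (σ π₁ x)
  step₁ x cx ne = trans (cong (canon π) (σ̃-ι₁ x (notLastTop₁ x cx ne))) (canon-ι₁ (σ̃ π₁ x) σ̃x≢e₁)
    where
    σ̃x≢e₁ : σ̃ π₁ x ≢ inn D₁.lastTop
    σ̃x≢e₁ e = ne (trans (cong (canon π₁) e) (D₁.canon-innLast D₁.lastTop D₁.tpos-lastTop))

  hit₁ : D₁.lastTop ≢ D₁.lastBot → ∀ x → Canonical π₁ x → σ π₁ x ≡ R₁ → σ π (ι₁ x) ≡ e₁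
  hit₁ R₁-moves x cx e with D₁.canon≡R (σ̃ π₁ x) e
  ... | inj₁ into-e₁ = trans (cong (canon π) (trans (σ̃-ι₁ x (notLastTop₁′ R₁-moves x cx)) (cong ι₁ into-e₁)))
                             (D.canon-innEarlier (inj₁ D₁.lastTop) (tpos₁≢N _))
  ... | inj₂ into-R₁ = ⊥-elim (notLastTop₁′ R₁-moves x cx (D₁.σ̃-into-lastBot x into-R₁))

  step₂ : ∀ y → Canonical π₂ y → σ π₂ y ≢ L₂ → σ π (ι₂ y) ≡ ι₂ (σ π₂ y)
  step₂ y cy ne = trans (cong (canon π) (σ̃-ι₂ y (notFirstBot₂ y cy ne))) (canon-ι₂ (σ̃ π₂ y) σ̃y≢e₂)
    where
    σ̃y≢e₂ : σ̃ π₂ y ≢ out D₂.firstBot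
    σ̃y≢e₂ e = ne (trans (cong (canon π₂) e) (D₂.canon-outFirst D₂.firstBot (D₂.bpos-πb⁻¹ zero)))

  hit₂ : D₂.firstTop ≢ D₂.firstBot → ∀ y → Canonical π₂ y → σ π₂ y ≡ L₂ → σ π (ι₂ y) ≡ e₂
  hit₂ L₂-moves y cy e with D₂.canon≡L (σ̃ π₂ y) e
  ... | inj₁ into-e₂ = trans (cong (canon π) (trans (σ̃-ι₂ y (notFirstBot₂′ L₂-moves y cy)) (cong ι₂ into-e₂)))
                             (D.canon-outLater (inj₂ D₂.firstBot) (bpos₂≢0 _))
  ... | inj₂ into-L₂ = ⊥-elim (notFirstBot₂′ L₂-moves y cy (D₂.σ̃-into-firstTop y into-L₂))

  C-ι₁ : D₁.lastTop ≢ D₁.lastBot → ∀ x → Canonical π₁ x → Canonical π (ι₁ x)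
  C-ι₁ R₁-moves x cx = trans (canon-ι₁ x (notLastTop₁′ R₁-moves x cx)) (cong ι₁ cx)
  C-ι₂ : D₂.firstTop ≢ D₂.firstBot → ∀ y → Canonical π₂ y → Canonical π (ι₂ y)
  C-ι₂ L₂-moves y cy = trans (canon-ι₂ y (notFirstBot₂′ L₂-moves y cy)) (cong ι₂ cy)

  e₁≢ι₁ : D₁.lastTop ≢ D₁.lastBot → ∀ x → Canonical π₁ x → e₁ ≢ ι₁ x
  e₁≢ι₁ R₁-moves x cx e = notLastTop₁′ R₁-moves x cx (sym (ι₁-inj e))
  e₂≢ι₂ : D₂.firstTop ≢ D₂.firstBot → ∀ y → Canonical π₂ y → e₂ ≢ ι₂ y
  e₂≢ι₂ L₂-moves y cy e = notFirstBot₂′ L₂-moves y cy (sym (ι₂-inj e))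

  C-cases : ∀ z → Canonical π z →
    (Σ (Sym A) λ x → Canonical π₁ x × z ≡ ι₁ x) ⊎ (Σ (Sym B) λ y → Canonical π₂ y × z ≡ ι₂ y)
    ⊎ z ≡ e₁ ⊎ z ≡ e₂
  C-cases (out (inj₁ a)) cz = inj₁ (out a , ι₁-inj (trans (sym (canon-ι₁ (out a) (λ ()))) cz) , refl)
  C-cases (inn (inj₁ a)) cz with a D₁.≟A D₁.lastTop
  ... | yes refl = inj₂ (inj₂ (inj₁ refl))
  ... | no ne = inj₁ (inn a , ι₁-inj (trans (sym (canon-ι₁ (inn a) (λ q → ne (D₁.inn-inj q)))) cz) , refl)
  C-cases (out (inj₂ b)) cz with b D₂.≟A D₂.firstBot
  ... | yes refl = inj₂ (inj₂ (inj₂ refl))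
  ... | no ne = inj₂ (inj₁ (out b , ι₂-inj (trans (sym (canon-ι₂ (out b) (λ q → ne (D₂.out-inj q)))) cz) , refl))
  C-cases (inn (inj₂ b)) cz = inj₂ (inj₁ (inn b , ι₂-inj (trans (sym (canon-ι₂ (inn b) (λ ()))) cz) , refl))

  A-before-B-top : ∀ a b → D.tpos (inj₁ a) < D.tpos (inj₂ b)
  A-before-B-top a b = begin-strict
    D.tpos (inj₁ a)    ≡⟨ tpos₁ a ⟩
    D₁.tpos a          ≤⟨ D₁.tpos≤ a ⟩
    k₁                 <⟨ ℕP.n<1+n k₁ ⟩
    suc k₁             ≤⟨ ℕP.m≤m+n (suc k₁) (D₂.tpos b) ⟩
    suc k₁ + D₂.tpos b ≡⟨ tpos₂ b ⟨
    D.tpos (inj₂ b)    ∎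
    where open ℕP.≤-Reasoning

  A-before-B-bot : ∀ a b → D.bpos (inj₁ a) < D.bpos (inj₂ b)
  A-before-B-bot a b = begin-strict
    D.bpos (inj₁ a)    ≡⟨ bpos₁ a ⟩
    D₁.bpos a          ≤⟨ D₁.bpos≤ a ⟩
    k₁                 <⟨ ℕP.n<1+n k₁ ⟩
    suc k₁             ≤⟨ ℕP.m≤m+n (suc k₁) (D₂.bpos b) ⟩
    suc k₁ + D₂.bpos b ≡⟨ bpos₂ b ⟨
    D.bpos (inj₂ b)    ∎
    where open ℕP.≤-Reasoning

  bot-junction : ∀ a {j} → D.bpos (inj₁ a) ≡ k₁ + j → a ≡ D₁.lastBot
  bot-junction a {j} e = D₁.bpos-inj (trans (ℕP.≤-antisym (D₁.bpos≤ a) k₁≤) (sym D₁.bpos-lastBot))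
    where
    k₁≤ : k₁ ≤ D₁.bpos a
    k₁≤ = subst (k₁ ≤_) (trans (sym e) (bpos₁ a)) (ℕP.m≤m+n k₁ j)

  top-junction : ∀ a c → D.tpos (inj₂ c) ≡ suc (D.tpos (inj₁ a)) → c ≡ D₂.firstTop
  top-junction a c e =
    D₂.tpos-inj (trans (ℕP.n≤0⇒n≡0 (ℕP.+-cancelˡ-≤ (suc k₁) _ 0 le)) (sym (D₂.tpos-πt⁻¹ zero)))
    where
    le : suc k₁ + D₂.tpos c ≤ suc k₁ + 0
    le = begin
      suc k₁ + D₂.tpos c     ≡⟨ tpos₂ c ⟨
      D.tpos (inj₂ c)        ≡⟨ e ⟩
      suc (D.tpos (inj₁ a))  ≡⟨ cong suc (tpos₁ a) ⟩
      suc (D₁.tpos a)        ≤⟨ s≤s (D₁.tpos≤ a) ⟩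
      suc k₁                 ≡⟨ ℕP.+-identityʳ (suc k₁) ⟨
      suc k₁ + 0             ∎
      where open ℕP.≤-Reasoning

  OnA OnB : Sym (A ⊎ B) → Set
  OnA (out (inj₁ _)) = ⊤
  OnA (inn (inj₁ _)) = ⊤
  OnA _ = ⊥
  OnB (out (inj₂ _)) = ⊤
  OnB (inn (inj₂ _)) = ⊤
  OnB _ = ⊥

  canon-OnB : ∀ w → OnB w → OnB (canon π w)
  canon-OnB (out (inj₂ b)) _ = subst OnB (sym (D.canon-outLater (inj₂ b) (bpos₂≢0 b))) tt
  canon-OnB (inn (inj₂ b)) _ with D.tpos (inj₂ b) ℕ.≟ N
  ... | yes e = subst OnB (sym (trans (D.canon-innLast (inj₂ b) e) (cong inn lastBot≡))) tt
  ... | no ne = subst OnB (sym (D.canon-innEarlier (inj₂ b) ne)) tt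

  canon-OnA : ∀ w → OnA w → OnA (canon π w)
  canon-OnA (out (inj₁ a)) _ with D.bpos (inj₁ a) ℕ.≟ 0
  ... | yes e = subst OnA (sym (D.canon-outFirst (inj₁ a) e)) tt
  ... | no ne = subst OnA (sym (D.canon-outLater (inj₁ a) ne)) tt
  canon-OnA (inn (inj₁ a)) _ = subst OnA (sym (D.canon-innEarlier (inj₁ a) (tpos₁≢N a))) tt

  RSide : Sym (A ⊎ B) → Set
  RSide z = z ≡ ι₁ R₁ ⊎ OnB z

  RSide-closed : D₁.lastTop ≡ D₁.lastBot → ∀ z → RSide z → RSide (σ π z)
  RSide-closed eq z (inj₁ refl) =
    inj₂ (subst OnB (sym (trans (cong (λ w → σ π (inn (inj₁ w))) (sym eq)) bridge₁)) tt)
  RSide-closed eq (inn (inj₂ b)) (inj₂ _) with D.tpos (inj₂ b) ℕ.≟ N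
  ... | yes last =
        inj₂ (subst OnB (sym (trans (cong (canon π) (D.σ̃-innLast (inj₂ b) last)) (trans D.R-canonical R≡))) tt)
  ... | no notLast with D.σ̃-innEarlier (inj₂ b) notLast
  ...   | inj₂ c , e , _ = inj₂ (subst OnB (cong (canon π) (sym e)) (canon-OnB (out (inj₂ c)) tt))
  ...   | inj₁ a , _ , tpos-a =
          ⊥-elim (ℕP.<-asym (A-before-B-top a b) (subst (D.tpos (inj₂ b) <_) (sym tpos-a) (ℕP.n<1+n _)))
  RSide-closed eq (out (inj₂ b)) (inj₂ _) with D.σ̃-outLater (inj₂ b) (k₁ + D₂.bpos b) (bpos₂ b)
  ... | inj₂ c , e , _ = inj₂ (subst OnB (cong (canon π) (sym e)) (canon-OnB (inn (inj₂ c)) tt))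
  ... | inj₁ a , e , bpos-a = inj₁ (trans (cong (canon π) e)
          (trans (D.canon-innEarlier (inj₁ a) (tpos₁≢N a)) (cong (λ w → inn (inj₁ w)) (bot-junction a bpos-a))))

  LSide : Sym (A ⊎ B) → Set
  LSide z = OnA z ⊎ z ≡ ι₂ L₂

  LSide-closed : D₂.firstTop ≡ D₂.firstBot → ∀ z → LSide z → LSide (σ π z)
  LSide-closed eq z (inj₂ refl) =
    inj₁ (subst OnA (sym (trans (cong (λ w → σ π (out (inj₂ w))) eq) bridge₂)) tt)
  LSide-closed eq (out (inj₁ a)) (inj₁ _) with D₁.bpos a in eb
  ... | zero = inj₁ (subst OnA (cong (canon π) (sym (D.σ̃-outFirst (inj₁ a) (trans (bpos₁ a) eb))))
                      (canon-OnA (out D.firstTop) tt))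
  ... | suc j with D.σ̃-outLater (inj₁ a) j (trans (bpos₁ a) eb)
  ...   | inj₁ c , e , _ = inj₁ (subst OnA (cong (canon π) (sym e)) (canon-OnA (inn (inj₁ c)) tt))
  ...   | inj₂ c , _ , bpos-c =
          ⊥-elim (ℕP.<-asym (A-before-B-bot a c) (subst (_< D.bpos (inj₁ a)) (sym bpos-c)
                   (subst (j <_) (sym (trans (bpos₁ a) eb)) (ℕP.n<1+n j))))
  LSide-closed eq (inn (inj₁ a)) (inj₁ _) with D.σ̃-innEarlier (inj₁ a) (tpos₁≢N a)
  ... | inj₁ c , e , _ = inj₁ (subst OnA (cong (canon π) (sym e)) (canon-OnA (out (inj₁ c)) tt))
  ... | inj₂ c , e , tpos-c = inj₂ (trans (cong (canon π) e)
          (trans (D.canon-outLater (inj₂ c) (bpos₂≢0 c)) (cong (λ w → out (inj₂ w)) (top-junction a c tpos-c))))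

  e₁≢ι₂ : ∀ y → e₁ ≢ ι₂ y
  e₁≢ι₂ (out _) ()
  e₁≢ι₂ (inn _) ()

  e₂≢ι₁ : ∀ x → e₂ ≢ ι₁ x
  e₂≢ι₁ (out _) ()
  e₂≢ι₁ (inn _) ()

  gluing : D₁.lastTop ≢ D₁.lastBot → D₂.firstTop ≢ D₂.firstBot → Gluing
  gluing R₁-moves L₂-moves = record
    { X₁ = Sym A ; X₂ = Sym B ; X = Sym (A ⊎ B) ; f₁ = σ π₁ ; f₂ = σ π₂ ; f = σ π
    ; C₁ = Canonical π₁ ; C₂ = Canonical π₂ ; C = Canonical π ; ι₁ = ι₁ ; ι₂ = ι₂
    ; S₁ = R₁ ; S₂ = L₂ ; e₁ = e₁ ; e₂ = e₂
    ; ι₁-inj = ι₁-inj ; ι₂-inj = ι₂-inj ; ι₁≢ι₂ = ι₁≢ι₂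
    ; e₁≢ι₁ = e₁≢ι₁ R₁-moves ; e₂≢ι₂ = e₂≢ι₂ L₂-moves
    ; e₁≢ι₂ = e₁≢ι₂ ; e₂≢ι₁ = e₂≢ι₁
    ; C₁-closed = λ x _ → D₁.σ-canonical x ; C₂-closed = λ y _ → D₂.σ-canonical y
    ; C₁S₁ = D₁.R-canonical ; C₂S₂ = D₂.L-canonical
    ; step₁ = step₁ ; hit₁ = hit₁ R₁-moves ; bridge₁ = bridge₁
    ; step₂ = step₂ ; hit₂ = hit₂ L₂-moves ; bridge₂ = bridge₂
    ; C-ι₁ = C-ι₁ R₁-moves ; C-ι₂ = C-ι₂ L₂-moves ; C-cases = C-cases
    ; _≟₁_ = D₁._≟Sym_ ; _≟₂_ = D₂._≟Sym_ }

parity : ∀ k → Σ ℕ λ q → k ≡ 2 * q ⊎ k ≡ suc (2 * q)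
parity zero = 0 , inj₁ refl
parity (suc k) with parity k
... | q , inj₁ refl = q , inj₂ refl
... | q , inj₂ refl = suc q , inj₁ (cong suc (sym (ℕP.+-suc q (q + 0))))

flips-even : ∀ q b → iter not (2 * q) b ≡ b
flips-even zero b = refl
flips-even (suc q) b = begin
  iter not (suc q + (suc q + 0)) b    ≡⟨ cong (λ k → iter not k b) (ℕP.+-suc (suc q) (q + 0)) ⟩
  not (not (iter not (2 * q) b))      ≡⟨ not-involutive _ ⟩
  iter not (2 * q) b                  ≡⟨ flips-even q b ⟩
  b                                   ∎
  where open ≡-Reasoning

evenFlips : ∀ k b → iter not k b ≡ b → Σ ℕ λ q → k ≡ 2 * q
evenFlips k b e with parity k
... | q , inj₁ k-even = q , k-even
... | q , inj₂ refl = ⊥-elim (not-¬ refl (sym (trans (cong not (sym (flips-even q b))) e)))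

oddFlips : ∀ k b → iter not k b ≡ not b → Σ ℕ λ q → k ≡ suc (2 * q)
oddFlips k b e with parity k
... | q , inj₂ k-odd = q , k-odd
... | q , inj₁ refl = ⊥-elim (not-¬ (flips-even q b) e)

module Markings {A : Set} {n : ℕ} (π : LabPerm A n) where
  open Diagram π
  open Orbit (σ π)
  open Orbit.WithDecidableEquality (σ π) _≟Sym_

  L≢R : Lsym π ≢ Rsym π
  L≢R ()

  fixed-stays : ∀ {x} → σ π x ≡ x → ∀ k → iter (σ π) k x ≡ x
  fixed-stays {x} e k = iter-invariant (_≡ x) (λ z z≡x → trans (cong (σ π) z≡x) e) k x refl

  kind-iter : σ π (Lsym π) ≢ Lsym π → σ π (Rsym π) ≢ Rsym π →
              ∀ k x → Canonical π x → kind (iter (σ π) k x) ≡ iter not k (kind x)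
  kind-iter _ _ zero x cx = refl
  kind-iter L-moves R-moves (suc k) x cx =
    trans (σ-alternates L-moves R-moves _ (iter-invariant (Canonical π) (λ z _ → σ-canonical z) k x cx))
          (cong not (kind-iter L-moves R-moves k x cx))

  -- a fixed point reaches nothing else, so L and R move if they reach each other
  L-moves : Reaches (Lsym π) (Rsym π) → σ π (Lsym π) ≢ Lsym π
  L-moves (k , L→R) fixed = L≢R (trans (sym (fixed-stays fixed k)) L→R)

  R-moves : Reaches (Rsym π) (Lsym π) → σ π (Rsym π) ≢ Rsym π
  R-moves (k , R→L) fixed = L≢R (sym (trans (sym (fixed-stays fixed k)) R→L))

  roundTrip : ∀ {x y} k l → iter (σ π) (suc k) x ≡ y → iter (σ π) l y ≡ x →
              iter (σ π) (suc (l + k)) x ≡ x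
  roundTrip {x} k l x→y y→x = trans (cong (λ i → iter (σ π) i x) (sym (ℕP.+-suc l k)))
                                       (proj₂ (reaches-trans (suc k , x→y) (l , y→x)))

  R-cycle : ∀ {m a p′} → HasMarkedProfile π (m ∣ a) p′ → CycleLen π (Rsym π) (2 * m)
  R-cycle {m} {a} (clL , L→R , _) = cycleLength-along {2 * m} clL (suc (2 * a) , L→R)

  L-avoids : ∀ {ml mr p′} → HasMarkedProfile π (ml ⊙ mr) p′ → ∀ k → iter (σ π) k (Lsym π) ≢ Rsym π
  L-avoids (L↛R , _) k e = L↛R (k , e)

  R-avoids : ∀ {ml mr p′} → HasMarkedProfile π (ml ⊙ mr) p′ → ∀ k → iter (σ π) k (Rsym π) ≢ Lsym π
  R-avoids (L↛R , _ , clR , _) k e = L↛R (reaches-sym clR (k , e))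

  -- If L and R lie on one cycle, the marking is of the first type: the cycle
  -- and the distance from L to R are counted in steps of alternating kind,
  -- so the former is even and the latter odd.
  firstTypeFrom : Reaches (Lsym π) (Rsym π) → Reaches (Rsym π) (Lsym π) →
                  (∀ m → CycleLength (Lsym π) (2 * m) → Σ (List ℕ) λ ps → Profile π (m ∷ ps)) →
                  FirstType π
  firstTypeFrom (zero , L≡R) _ _ = ⊥-elim (L≢R L≡R)
  firstTypeFrom L↝R@(suc k , L→R) R↝L@(k′ , R→L) profileWith
    with firstReturn {t = k′ + k} (roundTrip k k′ L→R R→L) | firstVisit {k = suc k} L→R
  ... | P , clP@(_ , L-period , _) | d , L→R-first , earlier
    with evenFlips P false (trans (sym (kind-iter (L-moves L↝R) (R-moves R↝L) P (Lsym π) L-canonical))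
                                  (cong kind L-period))
       | oddFlips d false (trans (sym (kind-iter (L-moves L↝R) (R-moves R↝L) d (Lsym π) L-canonical))
                                 (cong kind L→R-first))
  ... | m , refl | a , refl =
        m , a , proj₁ (profileWith m clP) , clP , L→R-first , earlier , proj₂ (profileWith m clP)

module Concatenated {A B : Set} {k₁ k₂ : ℕ} (π₁ : LabPerm A k₁) (π₂ : LabPerm B k₂) where
  open Concatenation π₁ π₂
  module O₁ = Orbit (σ π₁)
  module O₂ = Orbit (σ π₂)
  module O = Orbit (σ π)
  module M₁ = Markings π₁
  module M₂ = Markings π₂

  L₁ : Sym A
  L₁ = Lsym π₁
  R₂ : Sym B
  R₂ = Rsym π₂

  R₁-moves : ∀ {m} → CycleLen π₁ R₁ (2 * m) → D₁.lastTop ≢ D₁.lastBot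
  R₁-moves {m} cl e = O₁.evenCycle-notFixed {m} cl (D₁.R-fixed e)

  L₂-moves : ∀ {m} → CycleLen π₂ L₂ (2 * m) → D₂.firstTop ≢ D₂.firstBot
  L₂-moves {m} cl e = O₂.evenCycle-notFixed {m} cl (D₂.L-fixed e)

  arith-∣∣ : ∀ a b → suc (2 * (a + b + 1)) ≡ suc (2 * b) + suc (suc (2 * a))
  arith-∣∣ = solve-∀

  concat-∣∣ : ∀ m a p′ n b q′ →
    HasMarkedProfile π₁ (m ∣ a) p′ → HasMarkedProfile π₂ (n ∣ b) q′ →
    HasMarkedProfile π ((m + n + 1) ∣ (a + b + 1)) (p′ ++ q′)
  concat-∣∣ m a p′ n b q′ mp₁@(clL₁ , L₁→R₁ , R₁-first , prof₁)
                          (clL₂ , L₂→R₂ , R₂-first , prof₂) =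
    clL , path , path-first , G.gluedProfile {m} {n} clR₁ clL₂ prof₁ prof₂
    where
    clR₁ : CycleLen π₁ R₁ (2 * m)
    clR₁ = M₁.R-cycle {m} {a} mp₁
    module G = Glued (gluing (R₁-moves {m} clR₁) (L₂-moves {n} clL₂))
    clL : CycleLen π (Lsym π) (2 * (m + n + 1))
    clL = O.cycleLength-along (G.gluedCycle {m} {n} clR₁ clL₂)
            (G.Side₁.hingeCycle-embed clR₁ (O₁.reaches-sym clL₁ (suc (2 * a) , L₁→R₁)))
    L₁-hits : G.Side₁.FirstHitAt L₁ (2 * a)
    L₁-hits = (λ j j<2a → R₁-first (suc j) (s≤s j<2a)) , L₁→R₁
    L₂-misses : G.Side₂.MissesFor L₂ (suc (2 * b))
    L₂-misses j j<d = proj₂ (proj₂ clL₂) (suc j) z<s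
                        (ℕP.≤-<-trans j<d (O₂.firstVisit<length clL₂ L₂→R₂ R₂-first))
    path : iter (σ π) (suc (2 * (a + b + 1))) (Lsym π) ≡ Rsym π
    path = begin
      iter (σ π) (suc (2 * (a + b + 1))) (Lsym π)
        ≡⟨ cong (λ i → iter (σ π) i (Lsym π)) (arith-∣∣ a b) ⟩
      iter (σ π) (suc (2 * b) + suc (suc (2 * a))) (ι₁ L₁)
        ≡⟨ G.crossingPath (suc (2 * b)) D₁.L-canonical L₁-hits L₂-misses ⟩
      ι₂ (iter (σ π₂) (suc (2 * b)) L₂)
        ≡⟨ cong ι₂ L₂→R₂ ⟩
      ι₂ R₂
        ≡⟨ R≡ ⟨
      Rsym π
        ∎
      where open ≡-Reasoning
    path-first : ∀ j → j < suc (2 * (a + b + 1)) → iter (σ π) j (Lsym π) ≢ Rsym π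
    path-first j j< e = G.crossingPath-first D₁.L-canonical L₁-hits L₂-misses R₂-first j
                          (subst (j <_) (arith-∣∣ a b) j<) (trans e R≡)

  concat-∣⊙ : ∀ m a p′ nl nr q′ →
    HasMarkedProfile π₁ (m ∣ a) p′ → HasMarkedProfile π₂ (nl ⊙ nr) q′ →
    HasMarkedProfile π ((m + nl + 1) ⊙ nr) (p′ ++ q′)
  concat-∣⊙ m a p′ nl nr q′ mp₁@(clL₁ , L₁→R₁ , _ , prof₁) mp₂@(_ , clL₂ , clR₂ , prof₂) =
    L↛R , clL , clR , O.profile-↭ (G.gluedProfile {m} {nl} clR₁ clL₂ prof₁ prof₂) reorder
    where
    clR₁ : CycleLen π₁ R₁ (2 * m)
    clR₁ = M₁.R-cycle {m} {a} mp₁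
    module G = Glued (gluing (R₁-moves {m} clR₁) (L₂-moves {nl} clL₂))
    clL : CycleLen π (Lsym π) (2 * (m + nl + 1))
    clL = O.cycleLength-along (G.gluedCycle {m} {nl} clR₁ clL₂)
            (G.Side₁.hingeCycle-embed clR₁ (O₁.reaches-sym clL₁ (suc (2 * a) , L₁→R₁)))
    clR : CycleLen π (Rsym π) (2 * nr)
    clR = subst (λ z → CycleLen π z (2 * nr)) (sym R≡)
            (G.Side₂.cycleLength-embed D₂.R-canonical (M₂.R-avoids mp₂) clR₂)
    L↛R : ¬ SameCycle π (Lsym π) (Rsym π)
    L↛R L→R = G.Side₂.avoiding↛ι₂ D₂.R-canonical (M₂.R-avoids mp₂)
                (subst (λ z → SameCycle π z (ι₁ L₁)) R≡ (O.reaches-sym clL L→R))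
    reorder : (m + nl + 1) ∷ nr ∷ p′ ++ q′ ↭ (m + nl + 1) ∷ p′ ++ nr ∷ q′
    reorder = prep _ (↭-sym (↭ₚ.shift nr p′ q′))

  concat-⊙∣ : ∀ ml mr p′ n b q′ →
    HasMarkedProfile π₁ (ml ⊙ mr) p′ → HasMarkedProfile π₂ (n ∣ b) q′ →
    HasMarkedProfile π (ml ⊙ (mr + n + 1)) (p′ ++ q′)
  concat-⊙∣ ml mr p′ n b q′ mp₁@(_ , clL₁ , clR₁ , prof₁) (clL₂ , L₂→R₂ , _ , prof₂) =
    L↛R , clL , clR ,
    O.profile-↭ (G.gluedProfile {mr} {n} clR₁ clL₂ (O₁.profile-↭ prof₁ (swap mr ml ↭-refl)) prof₂)
                (swap _ _ ↭-refl)
    where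
    module G = Glued (gluing (R₁-moves {mr} clR₁) (L₂-moves {n} clL₂))
    clL : CycleLen π (Lsym π) (2 * ml)
    clL = G.Side₁.cycleLength-embed D₁.L-canonical (M₁.L-avoids mp₁) clL₁
    clR : CycleLen π (Rsym π) (2 * (mr + n + 1))
    clR = subst (λ z → CycleLen π z (2 * (mr + n + 1))) (sym R≡)
            (O.cycleLength-along (G.gluedCycle {mr} {n} clR₁ clL₂) (G.onGlued-ι₂ clR₁ clL₂ (suc (2 * b) , L₂→R₂)))
    L↛R : ¬ SameCycle π (Lsym π) (Rsym π)
    L↛R L→R = G.Side₁.avoiding↛ι₂ D₁.L-canonical (M₁.L-avoids mp₁) (subst (SameCycle π (ι₁ L₁)) R≡ L→R)

  concat-⊙⊙ : ∀ ml mr p′ nl nr q′ →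
    HasMarkedProfile π₁ (ml ⊙ mr) p′ → HasMarkedProfile π₂ (nl ⊙ nr) q′ →
    HasMarkedProfile π (ml ⊙ nr) (p′ ++ q′ ++ (mr + nl + 1) ∷ [])
  concat-⊙⊙ ml mr p′ nl nr q′ mp₁@(_ , clL₁ , clR₁ , prof₁) mp₂@(_ , clL₂ , clR₂ , prof₂) =
    L↛R , clL , clR ,
    O.profile-↭ (G.gluedProfile {mr} {nl} clR₁ clL₂ (O₁.profile-↭ prof₁ (swap mr ml ↭-refl)) prof₂)
                (↭-sym reorder)
    where
    module G = Glued (gluing (R₁-moves {mr} clR₁) (L₂-moves {nl} clL₂))
    clL : CycleLen π (Lsym π) (2 * ml)
    clL = G.Side₁.cycleLength-embed D₁.L-canonical (M₁.L-avoids mp₁) clL₁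
    clR : CycleLen π (Rsym π) (2 * nr)
    clR = subst (λ z → CycleLen π z (2 * nr)) (sym R≡)
            (G.Side₂.cycleLength-embed D₂.R-canonical (M₂.R-avoids mp₂) clR₂)
    L↛R : ¬ SameCycle π (Lsym π) (Rsym π)
    L↛R L→R = G.Side₁.avoiding↛ι₂ D₁.L-canonical (M₁.L-avoids mp₁) (subst (SameCycle π (ι₁ L₁)) R≡ L→R)
    g : ℕ
    g = mr + nl + 1
    reorder : g ∷ ml ∷ p′ ++ nr ∷ q′ ↭ ml ∷ nr ∷ p′ ++ q′ ++ g ∷ []
    reorder = ↭-trans (swap g ml ↭-refl) (prep ml (↭-trans (prep g (↭ₚ.shift nr p′ q′))
                (↭-trans (swap g nr ↭-refl) (prep nr (↭-trans (↭ₚ.∷↭∷ʳ g (p′ ++ q′))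
                  (↭-reflexive (Listₚ.++-assoc p′ q′ (g ∷ []))))))))

  firstType⇐ : FirstType π₁ × FirstType π₂ → FirstType π
  firstType⇐ ((m , a , p′ , mp₁) , (n , b , q′ , mp₂)) =
    m + n + 1 , a + b + 1 , p′ ++ q′ , concat-∣∣ m a p′ n b q′ mp₁ mp₂

  -- Conversely, if L and R share a cycle of π, the hinges are not fixed, so
  -- π is glued from π₁ and π₂; that cycle passes through both hinges, so L₁
  -- and R₁ share a cycle of π₁ and L₂, R₂ one of π₂.
  firstType⇒ : FirstType π → FirstType π₁ × FirstType π₂
  firstType⇒ (m , a , p′ , (clL , L→R , _ , prof)) =
    M₁.firstTypeFrom (proj₁ side₁) (proj₂ side₁)
      (λ m₁ cl₁ → G.sideProfile prof D₁.L-canonical cl₁ (proj₁ side₁)) ,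
    M₂.firstTypeFrom (proj₂ side₂) (proj₁ side₂)
      (λ m₂ cl₂ → G′.sideProfile prof D₂.L-canonical cl₂ (0 , refl))
    where
    L→R₂ : iter (σ π) (suc (2 * a)) (ι₁ L₁) ≡ ι₂ R₂
    L→R₂ = trans L→R R≡
    R→L : SameCycle π (Rsym π) (Lsym π)
    R→L = O.reaches-sym clL (suc (2 * a) , L→R)
    R₁-moves′ : D₁.lastTop ≢ D₁.lastBot
    R₁-moves′ eq with subst RSide (proj₂ R→L)
                        (O.iter-invariant RSide (RSide-closed eq) (proj₁ R→L) (Rsym π) (inj₂ (subst OnB (sym R≡) tt)))
    ... | inj₁ ()
    ... | inj₂ ()
    L₂-moves′ : D₂.firstTop ≢ D₂.firstBot
    L₂-moves′ eq with subst LSide L→R₂ (O.iter-invariant LSide (LSide-closed eq) (suc (2 * a)) (Lsym π) (inj₁ tt))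
    ... | inj₁ ()
    ... | inj₂ ()
    module G = Glued (gluing R₁-moves′ L₂-moves′)
    module G′ = Glued (swapGluing (gluing R₁-moves′ L₂-moves′))
    side₁ : O₁.Reaches L₁ R₁ × O₁.Reaches R₁ L₁
    side₁ = G.crossingCycle D₁.L-canonical clL (suc (2 * a) , L→R₂)
    clR₂ : O.CycleLength (ι₂ R₂) (2 * m)
    clR₂ = O.cycleLength-along clL (suc (2 * a) , L→R₂)
    side₂ : O₂.Reaches R₂ L₂ × O₂.Reaches L₂ R₂
    side₂ = G′.crossingCycle D₂.R-canonical clR₂ (subst (λ z → O.Reaches z (ι₁ L₁)) R≡ R→L)

lemma5p6 : ∀ {A B : Set} {k₁ k₂ : ℕ} (π₁ : LabPerm A k₁) (π₂ : LabPerm B k₂) →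
    (∀ m a p′ n b q′ →
      HasMarkedProfile π₁ (m ∣ a) p′ → HasMarkedProfile π₂ (n ∣ b) q′ →
      HasMarkedProfile (π₁ · π₂) ((m + n + 1) ∣ (a + b + 1)) (p′ ++ q′))
  × (∀ m a p′ nl nr q′ →
      HasMarkedProfile π₁ (m ∣ a) p′ → HasMarkedProfile π₂ (nl ⊙ nr) q′ →
      HasMarkedProfile (π₁ · π₂) ((m + nl + 1) ⊙ nr) (p′ ++ q′))
  × (∀ ml mr p′ n b q′ →
      HasMarkedProfile π₁ (ml ⊙ mr) p′ → HasMarkedProfile π₂ (n ∣ b) q′ →
      HasMarkedProfile (π₁ · π₂) (ml ⊙ (mr + n + 1)) (p′ ++ q′))
  × (∀ ml mr p′ nl nr q′ →
      HasMarkedProfile π₁ (ml ⊙ mr) p′ → HasMarkedProfile π₂ (nl ⊙ nr) q′ →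
      HasMarkedProfile (π₁ · π₂) (ml ⊙ nr) (p′ ++ q′ ++ (mr + nl + 1) ∷ []))
  × (FirstType (π₁ · π₂) ⇔ (FirstType π₁ × FirstType π₂))
lemma5p6 π₁ π₂ =
  concat-∣∣ , concat-∣⊙ , concat-⊙∣ , concat-⊙⊙ , mk⇔ firstType⇒ firstType⇐
  where open Concatenated π₁ π₂
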